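{- Let $\sigma$ be a type 2 simple permutation of length $n$ (as defined in the context). For permutations $\alpha_1,\dots,\alpha_n$, the inflation $\sigma[\alpha_1,\dots,\alpha_n]$ avoids both $2143$ and $4231$ if and only if: $\alpha_2\in\mathcal{E}$ (the second point, which is the single point of region $A$); $\alpha_n\in\mathcal{F}$ (the last point); $\alpha_1$ is increasing, and $\alpha_i$ is increasing whenever $(i,\sigma(i))$ is $d$, $u$, a point of region $B$ other than the leftmost point of $B$, or a point of region $F$; $\alpha_i$ is decreasing whenever $(i,\sigma(i))$ is a point of region $D$; and $\alpha_i=1$ when $(i,\sigma(i))$ is the leftmost point of region $B$.
   Context: Permutations are arrangements $\pi(1)\cdots\pi(n)$ of $1,\dots,n$, viewed as points $(i,\pi(i))$. $\pi$ is contained in $\sigma$ if some subsequence of $\sigma$ is in the same relative order as $\pi$; otherwise $\sigma$ avoids $\pi$. $\operatorname{Av}(S)$ is the set of permutations avoiding all members of $S$; $\mathcal{E}=\operatorname{Av}(2143,312)$, $\mathcal{F}=\operatorname{Av}(2143,231)$. An interval is a set of contiguous entries whose values form consecutive integers; a permutation is simple if its only intervals are singletons and the whole permutation. For $\sigma$ of length $m$ and permutations $\alpha_1,\dots,\alpha_m$, the inflation $\sigma[\alpha_1,\dots,\alpha_m]$ is the permutation of length $\sum|\alpha_i|$ consisting of $m$ consecutive segments, the $i$th being an interval order-isomorphic to $\alpha_i$, such that picking one entry from each segment gives a sequence order-isomorphic to $\sigma$. Let $\sigma$ be a simple permutation of length $n\ge4$ avoiding $2143$ and $4231$ with $\ell=(1,\sigma(1))$,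 $r=(n,\sigma(n))$, highest point $u=(p_u,n)$, lowest point $d=(p_d,1)$, satisfying $1<p_d<p_u<n$ and $\sigma(n)<\sigma(1)$. Regions: $A$: $1<i<p_d$, $\sigma(1)<\sigma(i)<n$; $B$: $p_d<i<p_u$, $\sigma(1)<\sigma(i)<n$; $D$: $p_d<i<p_u$, $\sigma(n)<\sigma(i)<\sigma(1)$; $F$: $p_d<i<p_u$, $1<\sigma(i)<\sigma(n)$; $G$: $p_u<i<n$, $1<\sigma(i)<\sigma(n)$. Such $\sigma$ is of type 1 if $A$ and $G$ are both empty, type 2 if $|A|=1$ and $G$ is empty, type 4 if $|A|=|G|=1$. -}

module Defs where

open import Data.Nat using (ℕ; zero; suc; _+_; _∸_; _<_; _≤_; _<ᵇ_)
open import Data.Bool using (if_then_else_)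
open import Data.List using (List; []; _∷_; length; map; upTo; concat; zip; take; drop; reverse)
open import Data.Nat.ListAction using (sum)
open import Data.List.Relation.Binary.Permutation.Propositional using (_↭_)
open import Data.List.Relation.Binary.Sublist.Propositional using (_⊆_)
open import Data.Product using (_×_; _,_; ∃; Σ)
open import Data.Sum using (_⊎_)
open import Relation.Binary.PropositionalEquality using (_≡_)
open import Relation.Nullary using (¬_)

Perm : Set
Perm = List ℕ

IsPerm : Perm → Set
IsPerm xs = xs ↭ map suc (upTo (length xs))

get : {A : Set} → A → List A → ℕ → A
get d []       _       = d
get d (x ∷ xs) zero    = x
get d (x ∷ xs) (suc i) = get d xs i

-- 1-indexed value σ(i)
_⟨_⟩ : Perm → ℕ → ℕ
σ ⟨ i ⟩ = get 0 σ (i ∸ 1)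

OrderIso : Perm → List ℕ → Set
OrderIso p q = length p ≡ length q ×
  (∀ i j → i < length p → j < length p →
     (get 0 p i < get 0 p j → get 0 q i < get 0 q j) ×
     (get 0 q i < get 0 q j → get 0 p i < get 0 p j))

Contains : Perm → Perm → Set
Contains σ π = ∃ λ s → s ⊆ σ × OrderIso π s

Avoids : Perm → Perm → Set
Avoids σ π = ¬ Contains σ π

p2143 p4231 p312 p231 : Perm
p2143 = 2 ∷ 1 ∷ 4 ∷ 3 ∷ []
p4231 = 4 ∷ 2 ∷ 3 ∷ 1 ∷ []
p312  = 3 ∷ 1 ∷ 2 ∷ []
p231  = 2 ∷ 3 ∷ 1 ∷ []

In𝓔 In𝓕 : Perm → Set
In𝓔 α = Avoids α p2143 × Avoids α p312
In𝓕 α = Avoids α p2143 × Avoids α p231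

IsInterval : Perm → ℕ → ℕ → Set
IsInterval σ a k = 1 ≤ k × a + k ≤ length σ ×
  ∃ λ c → take k (drop a σ) ↭ map (c +_) (map suc (upTo k))

Simple : Perm → Set
Simple σ = ∀ a k → IsInterval σ a k → k ≡ 1 ⊎ k ≡ length σ

Increasing Decreasing : Perm → Set
Increasing α = α ≡ map suc (upTo (length α))
Decreasing α = α ≡ reverse (map suc (upTo (length α)))

-- inflation σ[α₁,…,αₘ]: block i is αᵢ shifted by the total size of the
-- blocks αⱼ with σ(j) < σ(i)
offset : Perm → List Perm → ℕ → ℕ
offset σ αs v = sum (map (λ { (w , β) → if w <ᵇ v then length β else 0 }) (zip σ αs))

inflate : Perm → List Perm → Perm
inflate σ αs = concat (map (λ { (v , α) → map (offset σ αs v +_) α }) (zip σ αs))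

module Regions (σ : Perm) (pd pu : ℕ) where
  n : ℕ
  n = length σ

  InA InB InD InF InG : ℕ → Set
  InA i = 1 < i × i < pd × σ ⟨ 1 ⟩ < σ ⟨ i ⟩ × σ ⟨ i ⟩ < n
  InB i = pd < i × i < pu × σ ⟨ 1 ⟩ < σ ⟨ i ⟩ × σ ⟨ i ⟩ < n
  InD i = pd < i × i < pu × σ ⟨ n ⟩ < σ ⟨ i ⟩ × σ ⟨ i ⟩ < σ ⟨ 1 ⟩
  InF i = pd < i × i < pu × 1 < σ ⟨ i ⟩ × σ ⟨ i ⟩ < σ ⟨ n ⟩
  InG i = pu < i × i < n × 1 < σ ⟨ i ⟩ × σ ⟨ i ⟩ < σ ⟨ n ⟩

  LeftmostB : ℕ → Set
  LeftmostB i = InB i × (∀ j → InB j → i ≤ j)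

  -- standing assumptions: σ simple of length n ≥ 4 avoiding 2143 and 4231,
  -- d = (pd, 1), u = (pu, n), 1 < pd < pu < n, σ(n) < σ(1)
  Setup : Set
  Setup = IsPerm σ × 4 ≤ n × Simple σ × Avoids σ p2143 × Avoids σ p4231 ×
          σ ⟨ pd ⟩ ≡ 1 × σ ⟨ pu ⟩ ≡ n ×
          1 < pd × pd < pu × pu < n × σ ⟨ n ⟩ < σ ⟨ 1 ⟩

  Type2 : Set
  Type2 = Setup × (∃ λ a → InA a × (∀ i → InA i → i ≡ a)) × (∀ i → ¬ InG i)

  Conditions : List Perm → Set
  Conditions αs =
    In𝓔 (α 2) × In𝓕 (α n) × Increasing (α 1) ×
    (∀ i → (i ≡ pd ⊎ i ≡ pu ⊎ (InB i × ¬ LeftmostB i) ⊎ InF i) → Increasing (α i)) ×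
    (∀ i → InD i → Decreasing (α i)) ×
    (∀ i → LeftmostB i → α i ≡ 1 ∷ [])
    where
    α : ℕ → Perm
    α i = get [] αs (i ∸ 1)

-- An occurrence of 2143 or 4231 in σ[α₁, …, αₙ] either takes one entry from each of four
-- blocks, which σ forbids, or lies inside one block, or splits over two or three blocks
-- in one of three ways ([21][4][3], [2][1][43], [21][43] for 2143; [4][23][1], [423][1],
-- [4][231] for 4231). A split needs a 21 or 12 inside some block together with a small pattern
-- of σ through that block. For σ of type 2, avoiding 2143 and 4231 fixes the outline of σ: the
-- point of A is σ's second entry, d its third and u its second-to-last, and the value just below
-- the second entry lies in B. Running through the possible positions (ℓ, the A point, d, B, D,
-- F, u, r) of the blocks involved, each split is excluded exactly by the stated conditions, and
-- conversely each violated condition produces a split.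

module Submission where

open import Defs
open import Data.Nat using (ℕ; zero; suc; pred; >-nonZero; _⊓_; _+_; _∸_; _<_; _≤_; z≤n; s≤s; _<ᵇ_; _<?_)
open import Data.Nat.Properties
open import Data.Bool using (T; true; false; if_then_else_)
open import Data.Unit using (tt)
open import Data.Empty using (⊥; ⊥-elim)
open import Data.Product using (_×_; _,_; ∃; Σ; proj₁; proj₂)
open import Data.Sum using (_⊎_; inj₁; inj₂)
open import Data.List using (List; []; _∷_; _++_; length; map; upTo; drop; take; concat; zip; reverse; applyUpTo; applyDownFrom; downFrom)
open import Data.List.Properties using (length-zipWith; length-++; length-map; length-upTo; map-upTo; length-reverse; reverse-map; reverse-upTo; length-downFrom)
open import Data.List.Membership.Propositional using (_∈_)
open import Data.List.Membership.Propositional.Properties using (∈-map⁻; ∈-map⁺; ∈-upTo⁻; ∈-upTo⁺)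
open import Data.List.Relation.Unary.Any using (here; there)
import Data.List.Relation.Unary.All as All
open import Data.List.Relation.Unary.AllPairs using (_∷_)
open import Data.List.Relation.Unary.Linked using (Linked; [-]; _∷_)
open import Data.List.Relation.Unary.Unique.Propositional using (Unique)
import Data.List.Relation.Unary.Unique.Propositional.Properties as Unique
open import Data.List.Relation.Binary.Sublist.Propositional using (_⊆_; []; _∷_; _∷ʳ_; ⊆-refl; ⊆-trans)
open import Data.List.Relation.Binary.Sublist.Propositional.Properties using (drop⁺; []⊆-universal)
open import Data.List.Relation.Binary.Permutation.Propositional using (_↭_; ↭-sym; ↭-trans; ↭-refl; ↭-prep; ↭-swap; ↭-reflexive; ↭⇒↭ₛ′)
open import Data.List.Relation.Binary.Permutation.Propositional.Properties using (∈-resp-↭; shift)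
import Data.List.Relation.Binary.Permutation.Setoid.Properties as SetoidPermutation
open import Data.Nat.ListAction using (sum)
open import Relation.Binary.Definitions using (tri<; tri≈; tri>)
open import Relation.Binary.PropositionalEquality
open import Relation.Nullary using (¬_; yes; no)
open import Function using (_∘_)
open import Function.Bundles using (_⇔_; mk⇔; Equivalence)

infixl 9 _!_
_!_ : List ℕ → ℕ → ℕ
xs ! i = get 0 xs i

get-map : ∀ {A B : Set} (f : A → B) {d : B} {d′ : A} (xs : List A) {i} →
          i < length xs → get d (map f xs) i ≡ f (get d′ xs i)
get-map f (x ∷ xs) {zero}  _         = refl
get-map f (x ∷ xs) {suc i} (s≤s i<) = get-map f xs i<

get-∈ : ∀ {A : Set} {d : A} (xs : List A) {i} → i < length xs → get d xs i ∈ xs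
get-∈ (x ∷ xs) {zero}  _         = here refl
get-∈ (x ∷ xs) {suc i} (s≤s i<) = there (get-∈ xs i<)

∈⇒get : ∀ {A : Set} {d : A} {x} {xs : List A} → x ∈ xs → ∃ λ i → i < length xs × get d xs i ≡ x
∈⇒get (here refl) = 0 , s≤s z≤n , refl
∈⇒get (there x∈) with ∈⇒get x∈
... | i , i< , eq = suc i , s≤s i< , eq

get-++ˡ : ∀ (xs ys : List ℕ) {i} → i < length xs → (xs ++ ys) ! i ≡ xs ! i
get-++ˡ (x ∷ xs) ys {zero}  _         = refl
get-++ˡ (x ∷ xs) ys {suc i} (s≤s i<) = get-++ˡ xs ys i<

get-++ʳ : ∀ (xs ys : List ℕ) i → (xs ++ ys) ! (length xs + i) ≡ ys ! i
get-++ʳ []       ys i = refl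
get-++ʳ (x ∷ xs) ys i = get-++ʳ xs ys i

get-ext : ∀ (xs ys : List ℕ) → length xs ≡ length ys →
          (∀ i → i < length xs → xs ! i ≡ ys ! i) → xs ≡ ys
get-ext []       []       _   _  = refl
get-ext (x ∷ xs) (y ∷ ys) len eq =
  cong₂ _∷_ (eq 0 (s≤s z≤n)) (get-ext xs ys (suc-injective len) (λ i i< → eq (suc i) (s≤s i<)))

get-applyUpTo : ∀ (f : ℕ → ℕ) m {i} → i < m → applyUpTo f m ! i ≡ f i
get-applyUpTo f (suc m) {zero}  _         = refl
get-applyUpTo f (suc m) {suc i} (s≤s i<) = get-applyUpTo (f ∘ suc) m i<

get-applyDownFrom : ∀ (f : ℕ → ℕ) m {i} → i < m → applyDownFrom f m ! i ≡ f (m ∸ suc i)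
get-applyDownFrom f (suc m) {zero}  _         = refl
get-applyDownFrom f (suc m) {suc i} (s≤s i<) = get-applyDownFrom f m i<

subst₄ : ∀ (R : ℕ → ℕ → ℕ → ℕ → Set) {a a′ b b′ c c′ d d′} →
         a ≡ a′ → b ≡ b′ → c ≡ c′ → d ≡ d′ → R a b c d → R a′ b′ c′ d′
subst₄ R refl refl refl refl r = r

-- Permutations of 1, …, m

oneTo : ℕ → List ℕ
oneTo m = map suc (upTo m)

length-oneTo : ∀ m → length (oneTo m) ≡ m
length-oneTo m = trans (length-map suc (upTo m)) (length-upTo m)

get-oneTo : ∀ m {i} → i < m → oneTo m ! i ≡ suc i
get-oneTo m {i} i< = trans (cong (_! i) (map-upTo suc m)) (get-applyUpTo suc m i<)

get-reverse-oneTo : ∀ m {i} → i < m → reverse (oneTo m) ! i ≡ m ∸ i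
get-reverse-oneTo m {i} i< = begin
  reverse (map suc (upTo m)) ! i  ≡⟨ cong (_! i) (sym (reverse-map suc (upTo m))) ⟩
  map suc (reverse (upTo m)) ! i  ≡⟨ cong (λ xs → map suc xs ! i) (reverse-upTo m) ⟩
  map suc (downFrom m) ! i        ≡⟨ get-map suc (downFrom m) (subst (i <_) (sym (length-downFrom m)) i<) ⟩
  suc (applyDownFrom (λ x → x) m ! i) ≡⟨ cong suc (get-applyDownFrom (λ x → x) m i<) ⟩
  suc (m ∸ suc i)                 ≡⟨ sym (+-∸-assoc 1 i<) ⟩
  m ∸ i                           ∎
  where open ≡-Reasoning

∈-oneTo⁻ : ∀ {m x} → x ∈ oneTo m → 1 ≤ x × x ≤ m
∈-oneTo⁻ x∈ with ∈-map⁻ suc x∈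
... | y , y∈ , refl = s≤s z≤n , ∈-upTo⁻ y∈

∈-oneTo⁺ : ∀ {m x} → 1 ≤ x → x ≤ m → x ∈ oneTo m
∈-oneTo⁺ {x = suc x} _ x≤ = ∈-map⁺ suc (∈-upTo⁺ x≤)

Unique-get-injective : ∀ (xs : List ℕ) → Unique xs → ∀ {i j} → i < length xs → j < length xs →
                       xs ! i ≡ xs ! j → i ≡ j
Unique-get-injective (x ∷ xs) (_ ∷ _)     {zero}  {zero}  _        _        _  = refl
Unique-get-injective (x ∷ xs) (x∉ ∷ _)    {zero}  {suc j} _        (s≤s j<) eq = ⊥-elim (All.lookup x∉ (get-∈ xs j<) eq)
Unique-get-injective (x ∷ xs) (x∉ ∷ _)    {suc i} {zero}  (s≤s i<) _        eq = ⊥-elim (All.lookup x∉ (get-∈ xs i<) (sym eq))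
Unique-get-injective (x ∷ xs) (_ ∷ uniq) {suc i} {suc j} (s≤s i<) (s≤s j<) eq =
  cong suc (Unique-get-injective xs uniq i< j< eq)

module Permutation {xs : List ℕ} (perm : IsPerm xs) where
  private
    m = length xs

  range : ∀ {i} → i < m → 1 ≤ xs ! i × xs ! i ≤ m
  range i< = ∈-oneTo⁻ (∈-resp-↭ perm (get-∈ xs i<))

  preimage : ∀ {v} → 1 ≤ v → v ≤ m → ∃ λ i → i < m × xs ! i ≡ v
  preimage 1≤v v≤m = ∈⇒get (∈-resp-↭ (↭-sym perm) (∈-oneTo⁺ 1≤v v≤m))

  injective : ∀ {i j} → i < m → j < m → xs ! i ≡ xs ! j → i ≡ j
  injective = Unique-get-injective xs uniq
    where
    uniq : Unique xs
    uniq = SetoidPermutation.Unique-resp-↭ (setoid ℕ) (↭⇒↭ₛ′ isEquivalence (↭-sym perm))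
             (Unique.map⁺ suc-injective (Unique.upTo⁺ m))

  distinct : ∀ {i j} → i < m → j < m → i ≢ j → xs ! i ≢ xs ! j
  distinct i< j< i≢j eq = i≢j (injective i< j< eq)

  compare : ∀ {i j} → i < m → j < m → i ≢ j → xs ! i < xs ! j ⊎ xs ! j < xs ! i
  compare {i} {j} i< j< i≢j with <-cmp (xs ! i) (xs ! j)
  ... | tri< lt _ _ = inj₁ lt
  ... | tri≈ _ eq _ = ⊥-elim (distinct i< j< i≢j eq)
  ... | tri> _ _ gt = inj₂ gt

adjacent<⇒< : ∀ (f : ℕ → ℕ) {m} → (∀ u → suc u < m → f u < f (suc u)) →
              ∀ {u v} → u < v → v < m → f u < f v
adjacent<⇒< f step {u} {suc v} (s≤s u≤v) v< with m≤n⇒m<n∨m≡n u≤v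
... | inj₁ u<v  = <-trans (adjacent<⇒< f step u<v (<-trans (n<1+n v) v<)) (step v v<)
... | inj₂ refl = step u v<

adjacent<⇒gap : ∀ (f : ℕ → ℕ) {m} → (∀ u → suc u < m → f u < f (suc u)) →
                ∀ u k → u + k < m → f u + k ≤ f (u + k)
adjacent<⇒gap f step u zero _ rewrite +-identityʳ u | +-identityʳ (f u) = ≤-refl
adjacent<⇒gap f step u (suc k) u+k< rewrite +-suc u k | +-suc (f u) k =
  ≤-<-trans (adjacent<⇒gap f step u k (<-trans (n<1+n _) u+k<)) (step (u + k) u+k<)

adjacent>⇒gap : ∀ (f : ℕ → ℕ) {m} → (∀ u → suc u < m → f (suc u) < f u) →
                ∀ u k → u + k < m → f (u + k) + k ≤ f u
adjacent>⇒gap f step u zero _ rewrite +-identityʳ u | +-identityʳ (f u) = ≤-refl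
adjacent>⇒gap f step u (suc k) u+k< rewrite +-suc u k | +-suc (f (suc (u + k))) k =
  <-≤-trans (+-monoˡ-< k (step (u + k) u+k<)) (adjacent>⇒gap f step u k (<-trans (n<1+n _) u+k<))

Has12 Has21 : List ℕ → Set
Has12 α = ∃ λ s → ∃ λ t → s < t × t < length α × α ! s < α ! t
Has21 α = ∃ λ s → ∃ λ t → s < t × t < length α × α ! t < α ! s

Increasing⇒¬Has21 : ∀ {α} → Increasing α → ¬ Has21 α
Increasing⇒¬Has21 {α} inc (s , t , s<t , t< , gt) = <-asym gt (subst₂ _<_
  (sym (trans (cong (_! s) inc) (get-oneTo _ (<-trans s<t t<))))
  (sym (trans (cong (_! t) inc) (get-oneTo _ t<))) (s≤s s<t))

Decreasing⇒¬Has12 : ∀ {α} → Decreasing α → ¬ Has12 α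
Decreasing⇒¬Has12 {α} dec (s , t , s<t , t< , lt) = <-asym lt (subst₂ _<_
  (sym (trans (cong (_! t) dec) (get-reverse-oneTo _ t<)))
  (sym (trans (cong (_! s) dec) (get-reverse-oneTo _ (<-trans s<t t<)))) (∸-monoʳ-< s<t (<⇒≤ t<)))

[1]⇒¬Has12 : ∀ {α} → α ≡ 1 ∷ [] → ¬ Has12 α
[1]⇒¬Has12 refl (zero  , t , s<t , s≤s t<0 , _) = <⇒≱ s<t t<0
[1]⇒¬Has12 refl (suc s , t , s<t , s≤s t<0 , _) = <⇒≱ (<-trans (s≤s z≤n) s<t) t<0

[1]⇒¬Has21 : ∀ {α} → α ≡ 1 ∷ [] → ¬ Has21 α
[1]⇒¬Has21 refl (zero  , t , s<t , s≤s t<0 , _) = <⇒≱ s<t t<0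
[1]⇒¬Has21 refl (suc s , t , s<t , s≤s t<0 , _) = <⇒≱ (<-trans (s≤s z≤n) s<t) t<0

module _ {α : List ℕ} (perm : IsPerm α) where
  private
    m = length α
    open Permutation perm

    upper-slack : ∀ {t} → t < m → t + (m ∸ suc t) < m
    upper-slack t< = ≤-reflexive (m+[n∸m]≡n t<)

  ¬Has21⇒Increasing : ¬ Has21 α → Increasing α
  ¬Has21⇒Increasing no21 = get-ext α (oneTo m) (sym (length-oneTo m))
                             (λ t t< → trans (value t<) (sym (get-oneTo m t<)))
    where
    ascent : ∀ u → suc u < m → α ! u < α ! suc u
    ascent u u< = ≤∧≢⇒< (≮⇒≥ (λ gt → no21 (u , suc u , n<1+n u , u< , gt)))
                        (distinct (<-trans (n<1+n u) u<) u< (<⇒≢ (n<1+n u)))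
    value : ∀ {t} → t < m → α ! t ≡ suc t
    value {t} t< = ≤-antisym upper lower
      where
      open ≤-Reasoning
      k = m ∸ suc t
      lower : suc t ≤ α ! t
      lower = begin
        1 + t      ≤⟨ +-monoˡ-≤ t (proj₁ (range (≤-<-trans z≤n t<))) ⟩
        α ! 0 + t  ≤⟨ adjacent<⇒gap (α !_) ascent 0 t t< ⟩
        α ! t      ∎
      upper : α ! t ≤ suc t
      upper = +-cancelˡ-≤ k _ _ (begin
        k + α ! t        ≡⟨ +-comm k (α ! t) ⟩
        α ! t + k        ≤⟨ adjacent<⇒gap (α !_) ascent t k (upper-slack t<) ⟩
        α ! (t + k)      ≤⟨ proj₂ (range (upper-slack t<)) ⟩
        m                ≡⟨ sym (m∸n+n≡m t<) ⟩
        k + suc t        ∎)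

  ¬Has12⇒Decreasing : ¬ Has12 α → Decreasing α
  ¬Has12⇒Decreasing no12 = get-ext α (reverse (oneTo m)) (sym (trans (length-reverse (oneTo m)) (length-oneTo m)))
                             (λ t t< → trans (value t<) (sym (get-reverse-oneTo m t<)))
    where
    descent : ∀ u → suc u < m → α ! suc u < α ! u
    descent u u< = ≤∧≢⇒< (≮⇒≥ (λ lt → no12 (u , suc u , n<1+n u , u< , lt)))
                         (distinct u< (<-trans (n<1+n u) u<) (>⇒≢ (n<1+n u)))
    value : ∀ {t} → t < m → α ! t ≡ m ∸ t
    value {t} t< = ≤-antisym upper lower
      where
      open ≤-Reasoning
      k = m ∸ suc t
      upper : α ! t ≤ m ∸ t
      upper = m+n≤o⇒m≤o∸n (α ! t) (begin
        α ! t + t  ≤⟨ adjacent>⇒gap (α !_) descent 0 t t< ⟩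
        α ! 0      ≤⟨ proj₂ (range (≤-<-trans z≤n t<)) ⟩
        m          ∎)
      lower : m ∸ t ≤ α ! t
      lower = begin
        m ∸ t              ≡⟨ +-∸-assoc 1 t< ⟩
        1 + k              ≤⟨ +-monoˡ-≤ k (proj₁ (range (upper-slack t<))) ⟩
        α ! (t + k) + k    ≤⟨ adjacent>⇒gap (α !_) descent t k (upper-slack t<) ⟩
        α ! t              ∎

¬Has12×¬Has21⇒[1] : ∀ (α : List ℕ) → IsPerm α → 1 ≤ length α → ¬ Has12 α → ¬ Has21 α → α ≡ 1 ∷ []
¬Has12×¬Has21⇒[1] (x ∷ []) perm _ _ _ = cong (_∷ []) (≤-antisym (proj₂ x-range) (proj₁ x-range))
  where x-range = Permutation.range perm (s≤s z≤n)
¬Has12×¬Has21⇒[1] (x ∷ y ∷ _) perm _ no12 no21 with Permutation.compare perm {0} {1} (s≤s z≤n) (s≤s (s≤s z≤n)) (λ ())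
... | inj₁ x<y = ⊥-elim (no12 (0 , 1 , s≤s z≤n , s≤s (s≤s z≤n) , x<y))
... | inj₂ y<x = ⊥-elim (no21 (0 , 1 , s≤s z≤n , s≤s (s≤s z≤n) , y<x))

-- Pattern occurrences as increasing sequences of positions

⊆-position : ∀ {xs ys : List ℕ} → xs ⊆ ys → ℕ → ℕ
⊆-position []       i       = i
⊆-position (y ∷ʳ τ) i       = suc (⊆-position τ i)
⊆-position (_ ∷ τ)  zero    = zero
⊆-position (_ ∷ τ)  (suc i) = suc (⊆-position τ i)

⊆-position-get : ∀ {xs ys} (τ : xs ⊆ ys) {i} → i < length xs → xs ! i ≡ ys ! ⊆-position τ i
⊆-position-get (y ∷ʳ τ)    i<       = ⊆-position-get τ i<
⊆-position-get (refl ∷ τ) {zero}  _        = refl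
⊆-position-get (refl ∷ τ) {suc i} (s≤s i<) = ⊆-position-get τ i<

⊆-position-< : ∀ {xs ys} (τ : xs ⊆ ys) {i} → i < length xs → ⊆-position τ i < length ys
⊆-position-< (y ∷ʳ τ) i<               = s≤s (⊆-position-< τ i<)
⊆-position-< (_ ∷ τ)  {zero}  _        = s≤s z≤n
⊆-position-< (_ ∷ τ)  {suc i} (s≤s i<) = s≤s (⊆-position-< τ i<)

⊆-position-mono : ∀ {xs ys} (τ : xs ⊆ ys) {i j} → i < j → j < length xs → ⊆-position τ i < ⊆-position τ j
⊆-position-mono (y ∷ʳ τ) i<j j<                           = s≤s (⊆-position-mono τ i<j j<)
⊆-position-mono (_ ∷ τ)  {zero}  {suc j} _         _        = s≤s z≤n
⊆-position-mono (_ ∷ τ)  {suc i} {suc j} (s≤s i<j) (s≤s j<) = s≤s (⊆-position-mono τ i<j j<)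

∷-⊆-drop : ∀ (xs : List ℕ) {i ys} → i < length xs → ys ⊆ drop (suc i) xs → (xs ! i ∷ ys) ⊆ drop i xs
∷-⊆-drop (x ∷ xs) {zero}  _        τ = refl ∷ τ
∷-⊆-drop (x ∷ xs) {suc i} (s≤s i<) τ = ∷-⊆-drop xs i< τ

drop-⊆-drop : ∀ (xs : List ℕ) {i j ys} → i ≤ j → ys ⊆ drop j xs → ys ⊆ drop i xs
drop-⊆-drop xs i≤j τ = ⊆-trans τ (drop⁺ i≤j ⊆-refl)

record Positions₃ (m : ℕ) : Set where
  constructor positions₃
  field
    i j k : ℕ
    i<j : i < j
    j<k : j < k
    k<m : k < m

record Positions₄ (m : ℕ) : Set where
  constructor positions₄
  field
    i j k l : ℕ
    i<j : i < j
    j<k : j < k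
    k<l : k < l
    l<m : l < m

Occurs₃ : (ℕ → ℕ → ℕ → Set) → List ℕ → Set
Occurs₃ R xs = Σ (Positions₃ (length xs)) λ p → let open Positions₃ p in
  R (xs ! i) (xs ! j) (xs ! k)

Occurs₄ : (ℕ → ℕ → ℕ → ℕ → Set) → List ℕ → Set
Occurs₄ R xs = Σ (Positions₄ (length xs)) λ p → let open Positions₄ p in
  R (xs ! i) (xs ! j) (xs ! k) (xs ! l)

sublist₃ : ∀ (xs : List ℕ) (p : Positions₃ (length xs)) → let open Positions₃ p in
           (xs ! i ∷ xs ! j ∷ xs ! k ∷ []) ⊆ xs
sublist₃ xs (positions₃ i j k i<j j<k k<m) =
  drop-⊆-drop xs {j = i} z≤n (∷-⊆-drop xs (<-trans i<j (<-trans j<k k<m))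
  (drop-⊆-drop xs i<j (∷-⊆-drop xs (<-trans j<k k<m)
  (drop-⊆-drop xs j<k (∷-⊆-drop xs k<m ([]⊆-universal _))))))

sublist₄ : ∀ (xs : List ℕ) (p : Positions₄ (length xs)) → let open Positions₄ p in
           (xs ! i ∷ xs ! j ∷ xs ! k ∷ xs ! l ∷ []) ⊆ xs
sublist₄ xs (positions₄ i j k l i<j j<k k<l l<m) =
  drop-⊆-drop xs {j = i} z≤n (∷-⊆-drop xs (<-trans i<j (<-trans j<k (<-trans k<l l<m)))
  (drop-⊆-drop xs i<j (∷-⊆-drop xs (<-trans j<k (<-trans k<l l<m))
  (drop-⊆-drop xs j<k (∷-⊆-drop xs (<-trans k<l l<m)
  (drop-⊆-drop xs k<l (∷-⊆-drop xs l<m ([]⊆-universal _))))))))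

Linked-adjacent : ∀ {xs : List ℕ} → Linked _<_ xs → ∀ u → suc u < length xs → xs ! u < xs ! suc u
Linked-adjacent [-]        _       (s≤s ())
Linked-adjacent (x<y ∷ _)  zero    _        = x<y
Linked-adjacent (_ ∷ rest) (suc u) (s≤s u<) = Linked-adjacent rest u u<

-- ranks lists the entries of s in the order given by the values of p
byRank⇒OrderIso : ∀ (p s ranks : List ℕ) → IsPerm p → length ranks ≡ length p →
                  s ≡ map (λ v → ranks ! pred v) p → Linked _<_ ranks → OrderIso p s
byRank⇒OrderIso p s ranks perm len refl linked =
  sym (length-map _ p) , λ x y x< y< → forward x< y< , backward x< y<
  where
  open Permutation perm
  rank : ∀ {x} → x < length p → s ! x ≡ ranks ! pred (p ! x)
  rank = get-map (λ v → ranks ! pred v) p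
  forward : ∀ {x y} → x < length p → y < length p → p ! x < p ! y → s ! x < s ! y
  forward {x} {y} x< y< lt = subst₂ _<_ (sym (rank x<)) (sym (rank y<))
    (adjacent<⇒< (ranks !_) (Linked-adjacent linked)
      (pred-mono-< {{>-nonZero (proj₁ (range x<))}} lt)
      (subst (pred (p ! y) <_) (sym len) (pred-mono-< {{>-nonZero (proj₁ (range y<))}} (s≤s (proj₂ (range y<))))))
  backward : ∀ {x y} → x < length p → y < length p → s ! x < s ! y → p ! x < p ! y
  backward {x} {y} x< y< lt with <-cmp (p ! x) (p ! y)
  ... | tri< p<p _ _ = p<p
  ... | tri≈ _ p≡p _ = ⊥-elim (<-irrefl (cong (s !_) (injective x< y< p≡p)) lt)
  ... | tri> _ _ p>p = ⊥-elim (<-asym lt (forward y< x< p>p))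

lit< : ∀ {m n} {_ : T (m <ᵇ n)} → m < n
lit< {m} {n} {m<ᵇn} = <ᵇ⇒< m n m<ᵇn

Is312 Is231 : ℕ → ℕ → ℕ → Set
Is312 a b c = b < c × c < a
Is231 a b c = c < a × a < b

Is2143 Is4231 : ℕ → ℕ → ℕ → ℕ → Set
Is2143 a b c d = b < a × a < d × d < c
Is4231 a b c d = d < b × b < c × c < a

Occurs312⇒Contains : ∀ {xs} → Occurs₃ Is312 xs → Contains xs p312
Occurs312⇒Contains {xs} (p@(positions₃ i j k _ _ _) , b<c , c<a) = _ , sublist₃ xs p ,
  byRank⇒OrderIso p312 _ (xs ! j ∷ xs ! k ∷ xs ! i ∷ []) (↭-sym (shift 3 (1 ∷ 2 ∷ []) [])) refl refl
    (b<c ∷ c<a ∷ [-])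

Occurs231⇒Contains : ∀ {xs} → Occurs₃ Is231 xs → Contains xs p231
Occurs231⇒Contains {xs} (p@(positions₃ i j k _ _ _) , c<a , a<b) = _ , sublist₃ xs p ,
  byRank⇒OrderIso p231 _ (xs ! k ∷ xs ! i ∷ xs ! j ∷ []) (shift 1 (2 ∷ 3 ∷ []) []) refl refl
    (c<a ∷ a<b ∷ [-])

Occurs2143⇒Contains : ∀ {xs} → Occurs₄ Is2143 xs → Contains xs p2143
Occurs2143⇒Contains {xs} (p@(positions₄ i j k l _ _ _ _) , b<a , a<d , d<c) = _ , sublist₄ xs p ,
  byRank⇒OrderIso p2143 _ (xs ! j ∷ xs ! i ∷ xs ! l ∷ xs ! k ∷ []) (↭-swap 2 1 (↭-swap 4 3 ↭-refl)) refl refl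
    (b<a ∷ a<d ∷ d<c ∷ [-])

Occurs4231⇒Contains : ∀ {xs} → Occurs₄ Is4231 xs → Contains xs p4231
Occurs4231⇒Contains {xs} (p@(positions₄ i j k l _ _ _ _) , d<b , b<c , c<a) = _ , sublist₄ xs p ,
  byRank⇒OrderIso p4231 _ (xs ! l ∷ xs ! j ∷ xs ! k ∷ xs ! i ∷ [])
    (↭-trans (shift 1 (4 ∷ 2 ∷ 3 ∷ []) []) (↭-prep 1 (↭-sym (shift 4 (2 ∷ 3 ∷ []) [])))) refl refl
    (d<b ∷ b<c ∷ c<a ∷ [-])

module Embedding {xs p s : List ℕ} (τ : s ⊆ xs) (iso : OrderIso p s) where
  private
    bound : ∀ {x} → x < length p → x < length s
    bound = subst (_ <_) (proj₁ iso)

  position : ℕ → ℕ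
  position = ⊆-position τ

  position-mono : ∀ x y → x < y → y < length p → position x < position y
  position-mono x y x<y y< = ⊆-position-mono τ x<y (bound y<)

  position-< : ∀ {x} → x < length p → position x < length xs
  position-< x< = ⊆-position-< τ (bound x<)

  position-order : ∀ x y → x < length p → y < length p → p ! x < p ! y → xs ! position x < xs ! position y
  position-order x y x< y< lt = subst₂ _<_ (⊆-position-get τ (bound x<)) (⊆-position-get τ (bound y<))
                                     (proj₁ (proj₂ iso x y x< y<) lt)

Contains312⇒Occurs : ∀ {xs} → Contains xs p312 → Occurs₃ Is312 xs
Contains312⇒Occurs (_ , τ , iso) =
  positions₃ (position 0) (position 1) (position 2) (position-mono 0 1 lit< lit<) (position-mono 1 2 lit< lit<) (position-< lit<) ,
  position-order 1 2 lit< lit< lit< , position-order 2 0 lit< lit< lit<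
  where open Embedding τ iso

Contains231⇒Occurs : ∀ {xs} → Contains xs p231 → Occurs₃ Is231 xs
Contains231⇒Occurs (_ , τ , iso) =
  positions₃ (position 0) (position 1) (position 2) (position-mono 0 1 lit< lit<) (position-mono 1 2 lit< lit<) (position-< lit<) ,
  position-order 2 0 lit< lit< lit< , position-order 0 1 lit< lit< lit<
  where open Embedding τ iso

Contains2143⇒Occurs : ∀ {xs} → Contains xs p2143 → Occurs₄ Is2143 xs
Contains2143⇒Occurs (_ , τ , iso) =
  positions₄ (position 0) (position 1) (position 2) (position 3)
    (position-mono 0 1 lit< lit<) (position-mono 1 2 lit< lit<) (position-mono 2 3 lit< lit<) (position-< lit<) ,
  position-order 1 0 lit< lit< lit< , position-order 0 3 lit< lit< lit< , position-order 3 2 lit< lit< lit<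
  where open Embedding τ iso

Contains4231⇒Occurs : ∀ {xs} → Contains xs p4231 → Occurs₄ Is4231 xs
Contains4231⇒Occurs (_ , τ , iso) =
  positions₄ (position 0) (position 1) (position 2) (position 3)
    (position-mono 0 1 lit< lit<) (position-mono 1 2 lit< lit<) (position-mono 2 3 lit< lit<) (position-< lit<) ,
  position-order 3 1 lit< lit< lit< , position-order 1 2 lit< lit< lit< , position-order 2 0 lit< lit< lit<
  where open Embedding τ iso

Occurs312⇒Has21 : ∀ {α} → Occurs₃ Is312 α → Has21 α
Occurs312⇒Has21 (positions₃ i j k i<j j<k k<m , b<c , c<a) = i , j , i<j , <-trans j<k k<m , <-trans b<c c<a

Occurs312⇒Has12 : ∀ {α} → Occurs₃ Is312 α → Has12 α
Occurs312⇒Has12 (positions₃ i j k i<j j<k k<m , b<c , c<a) = j , k , j<k , k<m , b<c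

Occurs231⇒Has21 : ∀ {α} → Occurs₃ Is231 α → Has21 α
Occurs231⇒Has21 (positions₃ i j k i<j j<k k<m , c<a , a<b) = i , k , <-trans i<j j<k , k<m , c<a

Occurs231⇒Has12 : ∀ {α} → Occurs₃ Is231 α → Has12 α
Occurs231⇒Has12 (positions₃ i j k i<j j<k k<m , c<a , a<b) = i , j , i<j , <-trans j<k k<m , a<b

Occurs2143⇒Has21 : ∀ {α} → Occurs₄ Is2143 α → Has21 α
Occurs2143⇒Has21 (positions₄ i j k l i<j j<k k<l l<m , b<a , a<d , d<c) = i , j , i<j , <-trans j<k (<-trans k<l l<m) , b<a

Occurs2143⇒Has12 : ∀ {α} → Occurs₄ Is2143 α → Has12 α
Occurs2143⇒Has12 (positions₄ i j k l i<j j<k k<l l<m , b<a , a<d , d<c) = i , l , <-trans i<j (<-trans j<k k<l) , l<m , a<d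

Occurs4231⇒Occurs312 : ∀ {α} → Occurs₄ Is4231 α → Occurs₃ Is312 α
Occurs4231⇒Occurs312 (positions₄ i j k l i<j j<k k<l l<m , d<b , b<c , c<a) = positions₃ i j k i<j j<k (<-trans k<l l<m) , b<c , c<a

Occurs4231⇒Occurs231 : ∀ {α} → Occurs₄ Is4231 α → Occurs₃ Is231 α
Occurs4231⇒Occurs231 (positions₄ i j k l i<j j<k k<l l<m , d<b , b<c , c<a) = positions₃ j k l j<k k<l l<m , d<b , b<c

blockStart : List (List ℕ) → ℕ → ℕ
blockStart Ls       zero    = 0
blockStart []       (suc b) = 0
blockStart (L ∷ Ls) (suc b) = length L + blockStart Ls b

block : List (List ℕ) → ℕ → List ℕ
block = get []

concat-position-< : ∀ (Ls : List (List ℕ)) {b t} → b < length Ls → t < length (block Ls b) →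
                    blockStart Ls b + t < length (concat Ls)
concat-position-< (L ∷ Ls) {zero}      _        t< = subst (_ <_) (sym (length-++ L)) (≤-trans t< (m≤m+n _ _))
concat-position-< (L ∷ Ls) {suc b} {t} (s≤s b<) t< =
  subst₂ _<_ (sym (+-assoc (length L) (blockStart Ls b) t)) (sym (length-++ L))
    (+-monoʳ-< (length L) (concat-position-< Ls b< t<))

concat-get : ∀ (Ls : List (List ℕ)) {b t} → b < length Ls → t < length (block Ls b) →
             concat Ls ! (blockStart Ls b + t) ≡ block Ls b ! t
concat-get (L ∷ Ls) {zero}      _        t< = get-++ˡ L (concat Ls) t<
concat-get (L ∷ Ls) {suc b} {t} (s≤s b<) t< = begin
  (L ++ concat Ls) ! (length L + blockStart Ls b + t)    ≡⟨ cong ((L ++ concat Ls) !_) (+-assoc (length L) (blockStart Ls b) t) ⟩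
  (L ++ concat Ls) ! (length L + (blockStart Ls b + t))  ≡⟨ get-++ʳ L (concat Ls) (blockStart Ls b + t) ⟩
  concat Ls ! (blockStart Ls b + t)                      ≡⟨ concat-get Ls b< t< ⟩
  block (L ∷ Ls) (suc b) ! t                             ∎
  where open ≡-Reasoning

concat-position-surjective : ∀ (Ls : List (List ℕ)) {x} → x < length (concat Ls) →
  ∃ λ b → ∃ λ t → b < length Ls × t < length (block Ls b) × blockStart Ls b + t ≡ x
concat-position-surjective (L ∷ Ls) {x} x< with x <? length L
... | yes x<L = 0 , x , s≤s z≤n , x<L , refl
... | no x≮L with concat-position-surjective Ls x∸L<
  where
  x∸L< : x ∸ length L < length (concat Ls)
  x∸L< = subst (x ∸ length L <_) (m+n∸m≡n (length L) _) (∸-monoˡ-< (subst (x <_) (length-++ L) x<) (≮⇒≥ x≮L))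
...   | b , t , b< , t< , eq = suc b , t , s≤s b< , t< ,
        trans (+-assoc (length L) (blockStart Ls b) t) (trans (cong (length L +_) eq) (m+[n∸m]≡n (≮⇒≥ x≮L)))

blockStart-gap : ∀ (Ls : List (List ℕ)) {b b′} → b < b′ → b′ < length Ls →
                 blockStart Ls b + length (block Ls b) ≤ blockStart Ls b′
blockStart-gap (L ∷ Ls) {zero}  {suc b′} _        _          = m≤m+n _ _
blockStart-gap (L ∷ Ls) {suc b} {suc b′} (s≤s b<) (s≤s b′<) =
  subst (_≤ length L + blockStart Ls b′) (sym (+-assoc (length L) (blockStart Ls b) _))
    (+-monoʳ-≤ (length L) (blockStart-gap Ls b< b′<))

concat-position-across : ∀ (Ls : List (List ℕ)) {b b′ t} t′ → b < b′ → b′ < length Ls → t < length (block Ls b) →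
                         blockStart Ls b + t < blockStart Ls b′ + t′
concat-position-across Ls t′ b<b′ b′< t< =
  <-≤-trans (+-monoʳ-< _ t<) (≤-trans (blockStart-gap Ls b<b′ b′<) (m≤m+n _ t′))

concat-position-order : ∀ (Ls : List (List ℕ)) {b b′ t t′} → b < length Ls → b′ < length Ls →
  t < length (block Ls b) → t′ < length (block Ls b′) →
  blockStart Ls b + t < blockStart Ls b′ + t′ → b < b′ ⊎ (b ≡ b′ × t < t′)
concat-position-order Ls {b} {b′} {t} {t′} b< b′< t< t′< lt with <-cmp b b′
... | tri< b<b′ _ _ = inj₁ b<b′
... | tri≈ _ refl _ = inj₂ (refl , +-cancelˡ-< (blockStart Ls b) t t′ lt)
... | tri> _ _ b′<b = ⊥-elim (<-asym lt (concat-position-across Ls t b′<b b< t′<))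

-- Inflations

-- offset σ αs v unfolds to sum (map (sizeIfBelow v) (zip σ αs)).
sizeIfBelow : ℕ → ℕ × List ℕ → ℕ
sizeIfBelow v (w , β) = if w <ᵇ v then length β else 0

sizeIfBelow-mono : ∀ {v v′} (wβ : ℕ × List ℕ) → v ≤ v′ → sizeIfBelow v wβ ≤ sizeIfBelow v′ wβ
sizeIfBelow-mono {v} {v′} (w , β) v≤v′ with w <ᵇ v in w<v
... | false = z≤n
... | true with w <ᵇ v′ in w<v′
...   | true  = ≤-refl
...   | false = ⊥-elim (subst T w<v′ (<⇒<ᵇ (<-≤-trans (<ᵇ⇒< w v (subst T (sym w<v) tt)) v≤v′)))

sizeIfBelow-self : ∀ v β → sizeIfBelow v (v , β) ≡ 0
sizeIfBelow-self v β with v <ᵇ v in v<v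
... | false = refl
... | true  = ⊥-elim (<-irrefl refl (<ᵇ⇒< v v (subst T (sym v<v) tt)))

sizeIfBelow-< : ∀ {w v} β → w < v → sizeIfBelow v (w , β) ≡ length β
sizeIfBelow-< {w} {v} β w<v with w <ᵇ v in w<ᵇv
... | true  = refl
... | false = ⊥-elim (subst T w<ᵇv (<⇒<ᵇ w<v))

-- The blocks counted below level v′ include those counted below v < v′ and the block at level v.
sum-sizeIfBelow-gap : ∀ (ps : List (ℕ × List ℕ)) {v v′ b} → v < v′ → b < length ps →
  proj₁ (get (0 , []) ps b) ≡ v →
  sum (map (sizeIfBelow v) ps) + length (proj₂ (get (0 , []) ps b)) ≤ sum (map (sizeIfBelow v′) ps)
sum-sizeIfBelow-gap ((w , β) ∷ ps) {v′ = v′} {zero} w<v′ _ refl = begin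
  sizeIfBelow w (w , β) + sum (map (sizeIfBelow w) ps) + length β
    ≡⟨ cong (λ z → z + sum (map (sizeIfBelow w) ps) + length β) (sizeIfBelow-self w β) ⟩
  sum (map (sizeIfBelow w) ps) + length β
    ≡⟨ +-comm _ (length β) ⟩
  length β + sum (map (sizeIfBelow w) ps)
    ≤⟨ +-mono-≤ (≤-reflexive (sym (sizeIfBelow-< β w<v′))) (sum-mono ps) ⟩
  sizeIfBelow v′ (w , β) + sum (map (sizeIfBelow v′) ps) ∎
  where
  open ≤-Reasoning
  sum-mono : ∀ qs → sum (map (sizeIfBelow w) qs) ≤ sum (map (sizeIfBelow v′) qs)
  sum-mono []       = z≤n
  sum-mono (q ∷ qs) = +-mono-≤ (sizeIfBelow-mono q (<⇒≤ w<v′)) (sum-mono qs)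
sum-sizeIfBelow-gap ((w , β) ∷ ps) {v} {v′} {suc b} v<v′ (s≤s b<) eq =
  subst (_≤ sizeIfBelow v′ (w , β) + sum (map (sizeIfBelow v′) ps)) (sym (+-assoc (sizeIfBelow v (w , β)) _ _))
    (+-mono-≤ (sizeIfBelow-mono (w , β) (<⇒≤ v<v′)) (sum-sizeIfBelow-gap ps v<v′ b< eq))

get-zip : ∀ (σ : List ℕ) (αs : List (List ℕ)) {b} → b < length σ → length αs ≡ length σ →
          get (0 , []) (zip σ αs) b ≡ (σ ! b , get [] αs b)
get-zip (v ∷ σ) (α ∷ αs) {zero}  _        _   = refl
get-zip (v ∷ σ) (α ∷ αs) {suc b} (s≤s b<) len = get-zip σ αs b< (suc-injective len)

-- inflate σ αs unfolds to concat (inflationBlocks σ αs).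
inflationBlocks : Perm → List Perm → List (List ℕ)
inflationBlocks σ αs = map (λ p → map (offset σ αs (proj₁ p) +_) (proj₂ p)) (zip σ αs)

module Inflation (σ : Perm) (αs : List Perm) (len : length αs ≡ length σ) (σ-perm : IsPerm σ)
                 (αs-perm : ∀ α → α ∈ αs → IsPerm α × 1 ≤ length α) where
  n : ℕ
  n = length σ

  ι : Perm
  ι = inflate σ αs

  α : ℕ → Perm
  α = get [] αs

  offsetOf : ℕ → ℕ
  offsetOf b = offset σ αs (σ ! b)

  point : ℕ → ℕ → ℕ
  point b t = blockStart (inflationBlocks σ αs) b + t

  value : ℕ → ℕ → ℕ
  value b t = offsetOf b + α b ! t

  private
    Ls = inflationBlocks σ αs

    length-zip : length (zip σ αs) ≡ n
    length-zip = trans (length-zipWith _,_ σ αs) (trans (cong (n ⊓_) len) (⊓-idem n))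

    length-Ls : length Ls ≡ n
    length-Ls = trans (length-map _ (zip σ αs)) length-zip

    block≡ : ∀ {b} → b < n → block Ls b ≡ map (offsetOf b +_) (α b)
    block≡ {b} b< = trans (get-map _ (zip σ αs) (subst (b <_) (sym length-zip) b<))
                          (cong (λ p → map (offset σ αs (proj₁ p) +_) (proj₂ p)) (get-zip σ αs b< len))

    length-block : ∀ {b} → b < n → length (block Ls b) ≡ length (α b)
    length-block {b} b< = trans (cong length (block≡ b<)) (length-map _ (α b))

    b<Ls : ∀ {b} → b < n → b < length Ls
    b<Ls = subst (_ <_) (sym length-Ls)

    t<block : ∀ {b t} → b < n → t < length (α b) → t < length (block Ls b)
    t<block b< = subst (_ <_) (sym (length-block b<))

  α-perm : ∀ {b} → b < n → IsPerm (α b)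
  α-perm b< = proj₁ (αs-perm _ (get-∈ αs (subst (_ <_) (sym len) b<)))

  α-nonempty : ∀ {b} → b < n → 0 < length (α b)
  α-nonempty b< = proj₂ (αs-perm _ (get-∈ αs (subst (_ <_) (sym len) b<)))

  ι-at : ∀ {b t} → b < n → t < length (α b) → ι ! point b t ≡ value b t
  ι-at {b} {t} b< t< = trans (concat-get Ls (b<Ls b<) (t<block b< t<))
                        (trans (cong (_! t) (block≡ b<)) (get-map (offsetOf b +_) (α b) t<))

  point-< : ∀ {b t} → b < n → t < length (α b) → point b t < length ι
  point-< b< t< = concat-position-< Ls (b<Ls b<) (t<block b< t<)

  point-surjective : ∀ {x} → x < length ι → ∃ λ b → ∃ λ t → b < n × t < length (α b) × point b t ≡ x
  point-surjective x< with concat-position-surjective Ls x<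
  ... | b , t , b< , t< , eq = b , t , b<n , subst (t <_) (length-block b<n) t< , eq
    where b<n = subst (b <_) length-Ls b<

  point-across : ∀ {b b′ t} t′ → b < b′ → b′ < n → t < length (α b) → point b t < point b′ t′
  point-across t′ b<b′ b′< t< = concat-position-across Ls t′ b<b′ (b<Ls b′<) (t<block (<-trans b<b′ b′<) t<)

  point-within : ∀ b {t t′} → t < t′ → point b t < point b t′
  point-within b = +-monoʳ-< (blockStart Ls b)

  point-order : ∀ {b b′ t t′} → b < n → b′ < n → t < length (α b) → t′ < length (α b′) →
                point b t < point b′ t′ → b < b′ ⊎ (b ≡ b′ × t < t′)
  point-order b< b′< t< t′< = concat-position-order Ls (b<Ls b<) (b<Ls b′<) (t<block b< t<) (t<block b′< t′<)

  offset-gap : ∀ {b b′} → b < n → σ ! b < σ ! b′ → offsetOf b + length (α b) ≤ offsetOf b′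
  offset-gap {b} {b′} b< lt =
    subst (λ β → offsetOf b + length β ≤ offsetOf b′) (cong proj₂ (get-zip σ αs b< len))
      (sum-sizeIfBelow-gap (zip σ αs) lt (subst (b <_) (sym length-zip) b<) (cong proj₁ (get-zip σ αs b< len)))

  value-across : ∀ {b b′ t t′} → b < n → b′ < n → t < length (α b) → t′ < length (α b′) →
                 σ ! b < σ ! b′ → value b t < value b′ t′
  value-across {b} {b′} {t} {t′} b< b′< t< t′< lt = begin-strict
    offsetOf b + α b ! t        ≤⟨ +-monoʳ-≤ (offsetOf b) (proj₂ (Permutation.range (α-perm b<) t<)) ⟩
    offsetOf b + length (α b)   ≤⟨ offset-gap b< lt ⟩
    offsetOf b′                 <⟨ m<m+n (offsetOf b′) (proj₁ (Permutation.range (α-perm b′<) t′<)) ⟩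
    offsetOf b′ + α b′ ! t′     ∎
    where open ≤-Reasoning

  value-across⁻ : ∀ {b b′ t t′} → b < n → b′ < n → t < length (α b) → t′ < length (α b′) →
                  b ≢ b′ → value b t < value b′ t′ → σ ! b < σ ! b′
  value-across⁻ b< b′< t< t′< b≢b′ lt with Permutation.compare σ-perm b< b′< b≢b′
  ... | inj₁ σb<σb′ = σb<σb′
  ... | inj₂ σb′<σb = ⊥-elim (<-asym lt (value-across b′< b< t′< t< σb′<σb))

  value-within : ∀ b {t t′} → α b ! t < α b ! t′ → value b t < value b t′
  value-within b = +-monoʳ-< (offsetOf b)

  value-within⁻ : ∀ b {t t′} → value b t < value b t′ → α b ! t < α b ! t′
  value-within⁻ b = +-cancelˡ-< (offsetOf b) _ _

  record Point : Set where
    constructor pt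
    field
      blk idx : ℕ
      blk<    : blk < n
      idx<    : idx < length (α blk)

  first : ∀ {b} → b < n → Point
  first {b} b< = pt b 0 b< (α-nonempty b<)

  position height : Point → ℕ
  position (pt b t _ _) = point b t
  height   (pt b t _ _) = value b t

  pointAt : ∀ {x} → x < length ι → Σ Point λ p → position p ≡ x
  pointAt x< with point-surjective x<
  ... | b , t , b< , t< , eq = pt b t b< t< , eq

  record Points₄ (R : ℕ → ℕ → ℕ → ℕ → Set) : Set where
    constructor points₄
    field
      p₁ p₂ p₃ p₄ : Point
      p₁<p₂ : position p₁ < position p₂
      p₂<p₃ : position p₂ < position p₃
      p₃<p₄ : position p₃ < position p₄
      shape : R (height p₁) (height p₂) (height p₃) (height p₄)

  Points₄⇒Occurs₄ : ∀ {R} → Points₄ R → Occurs₄ R ι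
  Points₄⇒Occurs₄ {R} (points₄ (pt _ _ b₁< t₁<) (pt _ _ b₂< t₂<) (pt _ _ b₃< t₃<) (pt _ _ b₄< t₄<)
                               p₁<p₂ p₂<p₃ p₃<p₄ shape) =
    positions₄ _ _ _ _ p₁<p₂ p₂<p₃ p₃<p₄ (point-< b₄< t₄<) ,
    subst₄ R (sym (ι-at b₁< t₁<)) (sym (ι-at b₂< t₂<)) (sym (ι-at b₃< t₃<)) (sym (ι-at b₄< t₄<)) shape

  Occurs₄⇒Points₄ : ∀ {R} → Occurs₄ R ι → Points₄ R
  Occurs₄⇒Points₄ {R} (positions₄ i j k l i<j j<k k<l l< , shape)
    with pointAt (<-trans i<j (<-trans j<k (<-trans k<l l<))) | pointAt (<-trans j<k (<-trans k<l l<))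
       | pointAt (<-trans k<l l<) | pointAt l<
  ... | p₁@(pt _ _ b₁< t₁<) , refl | p₂@(pt _ _ b₂< t₂<) , refl
      | p₃@(pt _ _ b₃< t₃<) , refl | p₄@(pt _ _ b₄< t₄<) , refl =
    points₄ p₁ p₂ p₃ p₄ i<j j<k k<l
      (subst₄ R (ι-at b₁< t₁<) (ι-at b₂< t₂<) (ι-at b₃< t₃<) (ι-at b₄< t₄<) shape)

  -- How an occurrence meets the blocks: [21][4][3] is a 21 inside block b followed by one entry
  -- from each of the blocks c and e, spread uses one entry per block.
  data Split2143 : Set where
    spread     : Occurs₄ Is2143 σ → Split2143
    [21][4][3] : ∀ {b c e} → b < c → c < e → e < n → Has21 (α b) → σ ! b < σ ! e → σ ! e < σ ! c → Split2143
    [2][1][43] : ∀ {b c e} → b < c → c < e → e < n → Has21 (α e) → σ ! c < σ ! b → σ ! b < σ ! e → Split2143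
    [21][43]   : ∀ {b c} → b < c → c < n → Has21 (α b) → Has21 (α c) → σ ! b < σ ! c → Split2143
    [2143]     : ∀ {b} → b < n → Occurs₄ Is2143 (α b) → Split2143

  data Split4231 : Set where
    spread     : Occurs₄ Is4231 σ → Split4231
    [4][23][1] : ∀ {b c e} → b < c → c < e → e < n → Has12 (α c) → σ ! e < σ ! c → σ ! c < σ ! b → Split4231
    [423][1]   : ∀ {b e} → b < e → e < n → Occurs₃ Is312 (α b) → σ ! e < σ ! b → Split4231
    [4][231]   : ∀ {b c} → b < c → c < n → Occurs₃ Is231 (α c) → σ ! c < σ ! b → Split4231
    [4231]     : ∀ {b} → b < n → Occurs₄ Is4231 (α b) → Split4231

  private
    Points⇒Split2143 : Points₄ Is2143 → Split2143
    Points⇒Split2143 (points₄ (pt b₁ t₁ b₁< t₁<) (pt b₂ t₂ b₂< t₂<) (pt b₃ t₃ b₃< t₃<) (pt b₄ t₄ b₄< t₄<)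
                              x₁₂ x₂₃ x₃₄ (v₂<v₁ , v₁<v₄ , v₄<v₃))
      with point-order b₁< b₂< t₁< t₂< x₁₂ | point-order b₂< b₃< t₂< t₃< x₂₃ | point-order b₃< b₄< t₃< t₄< x₃₄
    ... | inj₁ b₁<b₂ | inj₁ b₂<b₃ | inj₁ b₃<b₄ =
      spread (positions₄ b₁ b₂ b₃ b₄ b₁<b₂ b₂<b₃ b₃<b₄ b₄< ,
              value-across⁻ b₂< b₁< t₂< t₁< (>⇒≢ b₁<b₂) v₂<v₁ ,
              value-across⁻ b₁< b₄< t₁< t₄< (<⇒≢ (<-trans b₁<b₂ (<-trans b₂<b₃ b₃<b₄))) v₁<v₄ ,
              value-across⁻ b₄< b₃< t₄< t₃< (>⇒≢ b₃<b₄) v₄<v₃)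
    ... | inj₂ (refl , t₁<t₂) | inj₁ b₁<b₃ | inj₁ b₃<b₄ =
      [21][4][3] b₁<b₃ b₃<b₄ b₄< (t₁ , t₂ , t₁<t₂ , t₂< , value-within⁻ b₁ v₂<v₁)
        (value-across⁻ b₁< b₄< t₁< t₄< (<⇒≢ (<-trans b₁<b₃ b₃<b₄)) v₁<v₄)
        (value-across⁻ b₄< b₃< t₄< t₃< (>⇒≢ b₃<b₄) v₄<v₃)
    ... | inj₁ b₁<b₂ | inj₂ (refl , _) | _ =
      ⊥-elim (<-asym (value-across⁻ b₂< b₁< t₂< t₁< (>⇒≢ b₁<b₂) v₂<v₁)
                     (value-across⁻ b₁< b₂< t₁< t₃< (<⇒≢ b₁<b₂) (<-trans v₁<v₄ v₄<v₃)))
    ... | inj₁ b₁<b₂ | inj₁ b₂<b₃ | inj₂ (refl , t₃<t₄) =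
      [2][1][43] b₁<b₂ b₂<b₃ b₃< (t₃ , t₄ , t₃<t₄ , t₄< , value-within⁻ b₃ v₄<v₃)
        (value-across⁻ b₂< b₁< t₂< t₁< (>⇒≢ b₁<b₂) v₂<v₁)
        (value-across⁻ b₁< b₃< t₁< t₄< (<⇒≢ (<-trans b₁<b₂ b₂<b₃)) v₁<v₄)
    ... | inj₂ (refl , t₁<t₂) | inj₁ b₁<b₃ | inj₂ (refl , t₃<t₄) =
      [21][43] b₁<b₃ b₃< (t₁ , t₂ , t₁<t₂ , t₂< , value-within⁻ b₁ v₂<v₁)
                         (t₃ , t₄ , t₃<t₄ , t₄< , value-within⁻ b₃ v₄<v₃)
        (value-across⁻ b₁< b₃< t₁< t₄< (<⇒≢ b₁<b₃) v₁<v₄)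
    ... | inj₂ (refl , _) | inj₂ (refl , _) | inj₁ b₁<b₄ =
      ⊥-elim (<-asym (value-across⁻ b₁< b₄< t₁< t₄< (<⇒≢ b₁<b₄) v₁<v₄)
                     (value-across⁻ b₄< b₁< t₄< t₃< (>⇒≢ b₁<b₄) v₄<v₃))
    ... | inj₂ (refl , t₁<t₂) | inj₂ (refl , t₂<t₃) | inj₂ (refl , t₃<t₄) =
      [2143] b₁< (positions₄ t₁ t₂ t₃ t₄ t₁<t₂ t₂<t₃ t₃<t₄ t₄< ,
                  value-within⁻ b₁ v₂<v₁ , value-within⁻ b₁ v₁<v₄ , value-within⁻ b₁ v₄<v₃)

    Points⇒Split4231 : Points₄ Is4231 → Split4231
    Points⇒Split4231 (points₄ (pt b₁ t₁ b₁< t₁<) (pt b₂ t₂ b₂< t₂<) (pt b₃ t₃ b₃< t₃<) (pt b₄ t₄ b₄< t₄<)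
                              x₁₂ x₂₃ x₃₄ (v₄<v₂ , v₂<v₃ , v₃<v₁))
      with point-order b₁< b₂< t₁< t₂< x₁₂ | point-order b₂< b₃< t₂< t₃< x₂₃ | point-order b₃< b₄< t₃< t₄< x₃₄
    ... | inj₁ b₁<b₂ | inj₁ b₂<b₃ | inj₁ b₃<b₄ =
      spread (positions₄ b₁ b₂ b₃ b₄ b₁<b₂ b₂<b₃ b₃<b₄ b₄< ,
              value-across⁻ b₄< b₂< t₄< t₂< (>⇒≢ (<-trans b₂<b₃ b₃<b₄)) v₄<v₂ ,
              value-across⁻ b₂< b₃< t₂< t₃< (<⇒≢ b₂<b₃) v₂<v₃ ,
              value-across⁻ b₃< b₁< t₃< t₁< (>⇒≢ (<-trans b₁<b₂ b₂<b₃)) v₃<v₁)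
    ... | inj₂ (refl , _) | inj₁ b₁<b₃ | _ =
      ⊥-elim (<-asym (value-across⁻ b₁< b₃< t₂< t₃< (<⇒≢ b₁<b₃) v₂<v₃)
                     (value-across⁻ b₃< b₁< t₃< t₁< (>⇒≢ b₁<b₃) v₃<v₁))
    ... | inj₁ b₁<b₂ | inj₂ (refl , t₂<t₃) | inj₁ b₂<b₄ =
      [4][23][1] b₁<b₂ b₂<b₄ b₄< (t₂ , t₃ , t₂<t₃ , t₃< , value-within⁻ b₂ v₂<v₃)
        (value-across⁻ b₄< b₂< t₄< t₂< (>⇒≢ b₂<b₄) v₄<v₂)
        (value-across⁻ b₂< b₁< t₃< t₁< (>⇒≢ b₁<b₂) v₃<v₁)
    ... | inj₁ _ | inj₁ b₂<b₃ | inj₂ (refl , _) =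
      ⊥-elim (<-asym (value-across⁻ b₃< b₂< t₄< t₂< (>⇒≢ b₂<b₃) v₄<v₂)
                     (value-across⁻ b₂< b₃< t₂< t₃< (<⇒≢ b₂<b₃) v₂<v₃))
    ... | inj₂ (refl , t₁<t₂) | inj₂ (refl , t₂<t₃) | inj₁ b₁<b₄ =
      [423][1] b₁<b₄ b₄< (positions₃ t₁ t₂ t₃ t₁<t₂ t₂<t₃ t₃< , value-within⁻ b₁ v₂<v₃ , value-within⁻ b₁ v₃<v₁)
        (value-across⁻ b₄< b₁< t₄< t₂< (>⇒≢ b₁<b₄) v₄<v₂)
    ... | inj₁ b₁<b₂ | inj₂ (refl , t₂<t₃) | inj₂ (refl , t₃<t₄) =
      [4][231] b₁<b₂ b₂< (positions₃ t₂ t₃ t₄ t₂<t₃ t₃<t₄ t₄< , value-within⁻ b₂ v₄<v₂ , value-within⁻ b₂ v₂<v₃)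
        (value-across⁻ b₂< b₁< t₃< t₁< (>⇒≢ b₁<b₂) v₃<v₁)
    ... | inj₂ (refl , t₁<t₂) | inj₂ (refl , t₂<t₃) | inj₂ (refl , t₃<t₄) =
      [4231] b₁< (positions₄ t₁ t₂ t₃ t₄ t₁<t₂ t₂<t₃ t₃<t₄ t₄< ,
                  value-within⁻ b₁ v₄<v₂ , value-within⁻ b₁ v₂<v₃ , value-within⁻ b₁ v₃<v₁)

    Split2143⇒Points : Split2143 → Points₄ Is2143
    Split2143⇒Points (spread (positions₄ b₁ b₂ b₃ b₄ b₁<b₂ b₂<b₃ b₃<b₄ b₄< , σ₂<σ₁ , σ₁<σ₄ , σ₄<σ₃)) =
      points₄ (first b₁<) (first b₂<) (first b₃<) (first b₄<)
        (point-across 0 b₁<b₂ b₂< (α-nonempty b₁<)) (point-across 0 b₂<b₃ b₃< (α-nonempty b₂<))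
        (point-across 0 b₃<b₄ b₄< (α-nonempty b₃<))
        (value-across b₂< b₁< (α-nonempty b₂<) (α-nonempty b₁<) σ₂<σ₁ ,
         value-across b₁< b₄< (α-nonempty b₁<) (α-nonempty b₄<) σ₁<σ₄ ,
         value-across b₄< b₃< (α-nonempty b₄<) (α-nonempty b₃<) σ₄<σ₃)
      where
      b₃< = <-trans b₃<b₄ b₄<
      b₂< = <-trans b₂<b₃ b₃<
      b₁< = <-trans b₁<b₂ b₂<
    Split2143⇒Points ([21][4][3] {b} {c} b<c c<e e< (t , t′ , t<t′ , t′< , desc) σb<σe σe<σc) =
      points₄ (pt b t b< (<-trans t<t′ t′<)) (pt b t′ b< t′<) (first c<) (first e<)
        (point-within b t<t′) (point-across 0 b<c c< t′<) (point-across 0 c<e e< (α-nonempty c<))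
        (value-within b desc , value-across b< e< (<-trans t<t′ t′<) (α-nonempty e<) σb<σe ,
         value-across e< c< (α-nonempty e<) (α-nonempty c<) σe<σc)
      where
      c< = <-trans c<e e<
      b< = <-trans b<c c<
    Split2143⇒Points ([2][1][43] {b} {c} {e} b<c c<e e< (t , t′ , t<t′ , t′< , desc) σc<σb σb<σe) =
      points₄ (first b<) (first c<) (pt e t e< (<-trans t<t′ t′<)) (pt e t′ e< t′<)
        (point-across 0 b<c c< (α-nonempty b<)) (point-across t c<e e< (α-nonempty c<)) (point-within e t<t′)
        (value-across c< b< (α-nonempty c<) (α-nonempty b<) σc<σb , value-across b< e< (α-nonempty b<) t′< σb<σe ,
         value-within e desc)
      where
      c< = <-trans c<e e<
      b< = <-trans b<c c<
    Split2143⇒Points ([21][43] {b} {c} b<c c< (t , t′ , t<t′ , t′< , descb) (s , s′ , s<s′ , s′< , descc) σb<σc) =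
      points₄ (pt b t b< (<-trans t<t′ t′<)) (pt b t′ b< t′<) (pt c s c< (<-trans s<s′ s′<)) (pt c s′ c< s′<)
        (point-within b t<t′) (point-across s b<c c< t′<) (point-within c s<s′)
        (value-within b descb , value-across b< c< (<-trans t<t′ t′<) s′< σb<σc , value-within c descc)
      where
      b< = <-trans b<c c<
    Split2143⇒Points ([2143] {b} b< (positions₄ i j k l i<j j<k k<l l< , r₁ , r₂ , r₃)) =
      points₄ (pt b i b< (<-trans i<j j<)) (pt b j b< j<) (pt b k b< k<) (pt b l b< l<)
        (point-within b i<j) (point-within b j<k) (point-within b k<l)
        (value-within b r₁ , value-within b r₂ , value-within b r₃)
      where
      k< = <-trans k<l l<
      j< = <-trans j<k k<

    Split4231⇒Points : Split4231 → Points₄ Is4231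
    Split4231⇒Points (spread (positions₄ b₁ b₂ b₃ b₄ b₁<b₂ b₂<b₃ b₃<b₄ b₄< , σ₄<σ₂ , σ₂<σ₃ , σ₃<σ₁)) =
      points₄ (first b₁<) (first b₂<) (first b₃<) (first b₄<)
        (point-across 0 b₁<b₂ b₂< (α-nonempty b₁<)) (point-across 0 b₂<b₃ b₃< (α-nonempty b₂<))
        (point-across 0 b₃<b₄ b₄< (α-nonempty b₃<))
        (value-across b₄< b₂< (α-nonempty b₄<) (α-nonempty b₂<) σ₄<σ₂ ,
         value-across b₂< b₃< (α-nonempty b₂<) (α-nonempty b₃<) σ₂<σ₃ ,
         value-across b₃< b₁< (α-nonempty b₃<) (α-nonempty b₁<) σ₃<σ₁)
      where
      b₃< = <-trans b₃<b₄ b₄<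
      b₂< = <-trans b₂<b₃ b₃<
      b₁< = <-trans b₁<b₂ b₂<
    Split4231⇒Points ([4][23][1] {b} {c} {e} b<c c<e e< (t , t′ , t<t′ , t′< , asc) σe<σc σc<σb) =
      points₄ (first b<) (pt c t c< (<-trans t<t′ t′<)) (pt c t′ c< t′<) (first e<)
        (point-across t b<c c< (α-nonempty b<)) (point-within c t<t′) (point-across 0 c<e e< t′<)
        (value-across e< c< (α-nonempty e<) (<-trans t<t′ t′<) σe<σc , value-within c asc ,
         value-across c< b< t′< (α-nonempty b<) σc<σb)
      where
      c< = <-trans c<e e<
      b< = <-trans b<c c<
    Split4231⇒Points ([423][1] {b} b<e e< (positions₃ i j k i<j j<k k< , r₁ , r₂) σe<σb) =
      points₄ (pt b i b< (<-trans i<j j<)) (pt b j b< j<) (pt b k b< k<) (first e<)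
        (point-within b i<j) (point-within b j<k) (point-across 0 b<e e< k<)
        (value-across e< b< (α-nonempty e<) j< σe<σb , value-within b r₁ , value-within b r₂)
      where
      b< = <-trans b<e e<
      j< = <-trans j<k k<
    Split4231⇒Points ([4][231] {b} {c} b<c c< (positions₃ i j k i<j j<k k< , r₁ , r₂) σc<σb) =
      points₄ (first b<) (pt c i c< (<-trans i<j j<)) (pt c j c< j<) (pt c k c< k<)
        (point-across i b<c c< (α-nonempty b<)) (point-within c i<j) (point-within c j<k)
        (value-within c r₁ , value-within c r₂ , value-across c< b< j< (α-nonempty b<) σc<σb)
      where
      b< = <-trans b<c c<
      j< = <-trans j<k k<
    Split4231⇒Points ([4231] {b} b< (positions₄ i j k l i<j j<k k<l l< , r₁ , r₂ , r₃)) =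
      points₄ (pt b i b< (<-trans i<j j<)) (pt b j b< j<) (pt b k b< k<) (pt b l b< l<)
        (point-within b i<j) (point-within b j<k) (point-within b k<l)
        (value-within b r₁ , value-within b r₂ , value-within b r₃)
      where
      k< = <-trans k<l l<
      j< = <-trans j<k k<

  ι⊇2143⇔Split : Contains ι p2143 ⇔ Split2143
  ι⊇2143⇔Split = mk⇔ (Points⇒Split2143 ∘ Occurs₄⇒Points₄ ∘ Contains2143⇒Occurs)
                     (Occurs2143⇒Contains ∘ Points₄⇒Occurs₄ ∘ Split2143⇒Points)

  ι⊇4231⇔Split : Contains ι p4231 ⇔ Split4231
  ι⊇4231⇔Split = mk⇔ (Points⇒Split4231 ∘ Occurs₄⇒Points₄ ∘ Contains4231⇒Occurs)
                     (Occurs4231⇒Contains ∘ Points₄⇒Occurs₄ ∘ Split4231⇒Points)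

Consecutive : ℕ → ℕ → Set
Consecutive x y = y ≡ suc x ⊎ x ≡ suc y

take2-drop : ∀ (σ : List ℕ) {b} → suc b < length σ → take 2 (drop b σ) ≡ σ ! b ∷ σ ! suc b ∷ []
take2-drop (x ∷ y ∷ σ) {zero}  _        = refl
take2-drop (x ∷ σ)     {suc b} (s≤s b<) = take2-drop σ b<

simple⇒¬Consecutive : ∀ {σ} → IsPerm σ → Simple σ → 3 ≤ length σ → ∀ {b} → suc b < length σ →
                      ¬ Consecutive (σ ! b) (σ ! suc b)
simple⇒¬Consecutive {σ} perm simple 3≤n {b} b+1< consecutive with simple b 2 (interval consecutive)
  where
  open Permutation perm
  σ!≡suc : ∀ {i} → i < length σ → σ ! i ≡ suc (pred (σ ! i))
  σ!≡suc i< = sym (suc-pred _ {{>-nonZero (proj₁ (range i<))}})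
  pair : ∀ {x y} c → x ≡ suc c → y ≡ suc x → (x ∷ y ∷ []) ↭ map (c +_) (oneTo 2)
  pair c refl refl = ↭-reflexive (cong₂ (λ u v → u ∷ v ∷ []) (+-comm 1 c) (+-comm 2 c))
  low : Consecutive (σ ! b) (σ ! suc b) → ℕ
  low (inj₁ _) = pred (σ ! b)
  low (inj₂ _) = pred (σ ! suc b)
  window : ∀ c → (σ ! b ∷ σ ! suc b ∷ []) ↭ map (low c +_) (oneTo 2)
  window (inj₁ up)   = pair _ (σ!≡suc (<-trans (n<1+n b) b+1<)) up
  window (inj₂ down) = ↭-trans (↭-swap _ _ ↭-refl) (pair _ (σ!≡suc b+1<) down)
  interval : Consecutive (σ ! b) (σ ! suc b) → IsInterval σ b 2
  interval c = s≤s z≤n , subst (_≤ length σ) (+-comm 2 b) b+1< , low c ,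
               subst (_↭ map (low c +_) (oneTo 2)) (sym (take2-drop σ b+1<)) (window c)
... | inj₁ ()
... | inj₂ 2≡n = <-irrefl 2≡n (≤-trans 3≤n ≤-refl)

-- The shape of a type 2 simple permutation

≢0∧≢1⇒>1 : ∀ {x} → x ≢ 0 → x ≢ 1 → 1 < x
≢0∧≢1⇒>1 {zero}        x≢0 _   = ⊥-elim (x≢0 refl)
≢0∧≢1⇒>1 {suc zero}    _   x≢1 = ⊥-elim (x≢1 refl)
≢0∧≢1⇒>1 {suc (suc x)} _   _   = s≤s (s≤s z≤n)

-- Positions are 0-indexed: ℓ, the point of A, d, u and r sit at 0, 1 (see A-point≡1), P, U and N.
module Type2
  (σ : Perm) (σ-perm : IsPerm σ) (4≤n : 4 ≤ length σ) (simple : Simple σ)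
  (σ⊉2143 : Avoids σ p2143) (σ⊉4231 : Avoids σ p4231)
  (P U N : ℕ) (N≡ : suc N ≡ length σ) (σP≡1 : σ ! P ≡ 1) (σU≡n : σ ! U ≡ length σ)
  (1<P : 1 < P) (P<U : P < U) (U<N : U < N) (σN<σ0 : σ ! N < σ ! 0)
  (a : ℕ) (A-unique : ∀ {b} → 0 < b → b < P → σ ! 0 < σ ! b → σ ! b < length σ → b ≡ a)
  (G-empty : ∀ {b} → U < b → b < N → 1 < σ ! b → σ ! b < σ ! N → ⊥) where

  n : ℕ
  n = length σ

  open Permutation σ-perm public

  N<n : N < n
  N<n = subst (N <_) N≡ ≤-refl

  U<n : U < n
  U<n = <-trans U<N N<n

  P<n : P < n
  P<n = <-trans P<U U<n

  0<n : 0 < n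
  0<n = ≤-trans (s≤s z≤n) 4≤n

  1<n : 1 < n
  1<n = ≤-trans (s≤s (s≤s z≤n)) 4≤n

  0<P : 0 < P
  0<P = <-trans (s≤s z≤n) 1<P

  <N : ∀ {x} → x < n → x ≢ N → x < N
  <N x< x≢N = ≤∧≢⇒< (≤-pred (subst (_ <_) (sym N≡) x<)) x≢N

  ¬2143 : ∀ {i j k l} → i < j → j < k → k < l → l < n → σ ! j < σ ! i → σ ! i < σ ! l → σ ! l < σ ! k → ⊥
  ¬2143 i<j j<k k<l l< r₁ r₂ r₃ = σ⊉2143 (Occurs2143⇒Contains (positions₄ _ _ _ _ i<j j<k k<l l< , r₁ , r₂ , r₃))

  ¬4231 : ∀ {i j k l} → i < j → j < k → k < l → l < n → σ ! l < σ ! j → σ ! j < σ ! k → σ ! k < σ ! i → ⊥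
  ¬4231 i<j j<k k<l l< r₁ r₂ r₃ = σ⊉4231 (Occurs4231⇒Contains (positions₄ _ _ _ _ i<j j<k k<l l< , r₁ , r₂ , r₃))

  ≢values : ∀ {x y} → σ ! x < σ ! y → x ≢ y
  ≢values lt refl = <-irrefl refl lt

  1<σ : ∀ {b} → b < n → b ≢ P → 1 < σ ! b
  1<σ b< b≢P = ≤∧≢⇒< (proj₁ (range b<)) (λ 1≡σb → distinct P<n b< (b≢P ∘ sym) (trans σP≡1 1≡σb))

  σ<n : ∀ {b} → b < n → b ≢ U → σ ! b < n
  σ<n b< b≢U = ≤∧≢⇒< (proj₂ (range b<)) (λ σb≡n → distinct b< U<n b≢U (trans σb≡n (sym σU≡n)))

  σP< : ∀ {b} → b < n → b ≢ P → σ ! P < σ ! b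
  σP< {b} b< b≢P = subst (_< σ ! b) (sym σP≡1) (1<σ b< b≢P)

  <σU : ∀ {b} → b < n → b ≢ U → σ ! b < σ ! U
  <σU {b} b< b≢U = subst (σ ! b <_) (sym σU≡n) (σ<n b< b≢U)

  ¬Consecutive : ∀ {b} → suc b < n → ¬ Consecutive (σ ! b) (σ ! suc b)
  ¬Consecutive = simple⇒¬Consecutive σ-perm simple (≤-trans (n≤1+n 3) 4≤n)

  σN<σ1 : σ ! N < σ ! 1
  σN<σ1 with compare N<n 1<n (>⇒≢ (<-trans 1<P (<-trans P<U U<N)))
  ... | inj₁ σN<σ1 = σN<σ1
  ... | inj₂ σ1<σN = ⊥-elim (¬2143 1<P P<U U<N N<n (σP< 1<n (<⇒≢ 1<P)) σ1<σN (<σU N<n (>⇒≢ U<N)))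

  -- If σ(1) < σ(0), the value σ(0) − 1 lies to the right of 1 and forms 4231 with 0, 1 and N.
  σ0<σ1 : σ ! 0 < σ ! 1
  σ0<σ1 with compare 0<n 1<n (λ ())
  ... | inj₁ σ0<σ1 = σ0<σ1
  ... | inj₂ σ1<σ0 = ⊥-elim (below (m≤n⇒m<n∨m≡n (≤-pred (subst (suc (σ ! 1) ≤_) σ0≡ σ1<σ0))))
    where
    v = pred (σ ! 0)
    σ0≡ : σ ! 0 ≡ suc v
    σ0≡ = sym (suc-pred _ {{>-nonZero (proj₁ (range 0<n))}})
    below : σ ! 1 < v ⊎ σ ! 1 ≡ v → ⊥
    below (inj₂ σ1≡v) = ¬Consecutive 1<n (inj₂ (trans σ0≡ (cong suc (sym σ1≡v))))
    below (inj₁ σ1<v) with preimage (≤-trans (proj₁ (range 1<n)) (<⇒≤ σ1<v))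
                                    (≤-trans (n≤1+n v) (subst (_≤ n) σ0≡ (proj₂ (range 0<n))))
    ... | x , x< , σx≡v = ¬4231 (s≤s z≤n) 1<x (<N x< x≢N) N<n σN<σ1 σ1<σx σx<σ0
      where
      σ1<σx : σ ! 1 < σ ! x
      σ1<σx = subst (σ ! 1 <_) (sym σx≡v) σ1<v
      σx<σ0 : σ ! x < σ ! 0
      σx<σ0 = subst₂ _<_ (sym σx≡v) (sym σ0≡) ≤-refl
      1<x : 1 < x
      1<x = ≢0∧≢1⇒>1 (≢values σx<σ0) (≢-sym (≢values σ1<σx))
      x≢N : x ≢ N
      x≢N = ≢-sym (≢values (<-trans σN<σ1 σ1<σx))

  A-point≡1 : ∀ {b} → 0 < b → b < P → σ ! 0 < σ ! b → σ ! b < n → b ≡ 1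
  A-point≡1 0<b b<P σ0<σb σb<n =
    trans (A-unique 0<b b<P σ0<σb σb<n) (sym (A-unique (s≤s z≤n) 1<P σ0<σ1 (σ<n 1<n (<⇒≢ (<-trans 1<P P<U)))))

  -- q is the position of the value σ(1) − 1; it lies in B.
  private
    w = pred (σ ! 1)

    σ1≡ : σ ! 1 ≡ suc w
    σ1≡ = sym (suc-pred _ {{>-nonZero (proj₁ (range 1<n))}})

    σ0<w : σ ! 0 < w
    σ0<w with m≤n⇒m<n∨m≡n (≤-pred (subst (suc (σ ! 0) ≤_) σ1≡ σ0<σ1))
    ... | inj₁ σ0<w = σ0<w
    ... | inj₂ σ0≡w = ⊥-elim (¬Consecutive 1<n (inj₁ (trans σ1≡ (cong suc (sym σ0≡w)))))

    w<σ1 : w < σ ! 1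
    w<σ1 = subst (w <_) (sym σ1≡) ≤-refl

    q-exists : ∃ λ x → x < n × σ ! x ≡ w
    q-exists = preimage (≤-trans (s≤s z≤n) σ0<w) (≤-trans (<⇒≤ w<σ1) (proj₂ (range 1<n)))

  q : ℕ
  q = proj₁ q-exists

  q<n : q < n
  q<n = proj₁ (proj₂ q-exists)

  σ0<σq : σ ! 0 < σ ! q
  σ0<σq = subst (σ ! 0 <_) (sym (proj₂ (proj₂ q-exists))) σ0<w

  σq<σ1 : σ ! q < σ ! 1
  σq<σ1 = subst (_< σ ! 1) (sym (proj₂ (proj₂ q-exists))) w<σ1

  P<q : P < q
  P<q with <-cmp q P
  ... | tri< q<P _ _ = ⊥-elim (≢values σq<σ1 (A-point≡1 (<-trans (s≤s z≤n) 1<q) q<P σ0<σq (<-trans σq<σ1 (σ<n 1<n 1≢U))))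
    where
    1<q = ≢0∧≢1⇒>1 (≢-sym (≢values σ0<σq)) (≢values σq<σ1)
    1≢U = <⇒≢ (<-trans 1<P P<U)
  ... | tri≈ _ q≡P _ = ⊥-elim (<⇒≱ (subst (σ ! 0 <_) (trans (cong (σ !_) q≡P) σP≡1) σ0<σq) (proj₁ (range 0<n)))
  ... | tri> _ _ P<q = P<q

  q<U : q < U
  q<U with <-cmp q U
  ... | tri< q<U _ _ = q<U
  ... | tri≈ _ q≡U _ = ⊥-elim (<⇒≱ (subst (_< σ ! 1) (trans (cong (σ !_) q≡U) σU≡n) σq<σ1) (proj₂ (range 1<n)))
  ... | tri> _ _ U<q with q ≟ N
  ...   | yes q≡N = ⊥-elim (<-asym (subst (λ i → σ ! i < σ ! 0) (sym q≡N) σN<σ0) σ0<σq)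
  ...   | no _     = ⊥-elim (¬2143 0<P P<U U<q q<n (σP< 0<n (<⇒≢ 0<P)) σ0<σq (<σU q<n (>⇒≢ U<q)))

  P≡2 : P ≡ 2
  P≡2 with m≤n⇒m<n∨m≡n 1<P
  ... | inj₂ 2≡P = sym 2≡P
  ... | inj₁ 2<P = ⊥-elim (C-empty (compare 0<n 2<n (λ ())))
    where
    2<n = <-trans 2<P P<n
    C-empty : σ ! 0 < σ ! 2 ⊎ σ ! 2 < σ ! 0 → ⊥
    C-empty (inj₁ σ0<σ2) with A-point≡1 (s≤s z≤n) 2<P σ0<σ2 (σ<n 2<n (<⇒≢ (<-trans 2<P P<U)))
    ... | ()
    C-empty (inj₂ σ2<σ0) with compare N<n 2<n (>⇒≢ (<-trans 2<P (<-trans P<U U<N)))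
    ... | inj₁ σN<σ2 = ¬4231 (s≤s (s≤s z≤n)) (<-trans 2<P P<q) (<-trans q<U U<N) N<n σN<σ2 (<-trans σ2<σ0 σ0<σq) σq<σ1
    ... | inj₂ σ2<σN = ¬2143 2<P P<U U<N N<n (σP< 2<n (<⇒≢ 2<P)) σ2<σN (<σU N<n (>⇒≢ U<N))

  U+1≡N : suc U ≡ N
  U+1≡N with m≤n⇒m<n∨m≡n U<N
  ... | inj₂ U+1≡N = U+1≡N
  ... | inj₁ U+1<N = ⊥-elim (H-empty (compare N<n b<n (>⇒≢ b<N)))
    where
    b = pred N
    N≡b+1 : N ≡ suc b
    N≡b+1 = sym (suc-pred N {{>-nonZero (≤-trans (s≤s z≤n) U<N)}})
    b<N : b < N
    b<N = subst (b <_) (sym N≡b+1) ≤-refl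
    b<n = <-trans b<N N<n
    U<b : U < b
    U<b = ≤-pred (subst (suc (suc U) ≤_) N≡b+1 U+1<N)
    H-empty : σ ! N < σ ! b ⊎ σ ! b < σ ! N → ⊥
    H-empty (inj₂ σb<σN) = G-empty U<b b<N (1<σ b<n (>⇒≢ (<-trans P<U U<b))) σb<σN
    H-empty (inj₁ σN<σb) with compare 0<n b<n (<⇒≢ (<-trans 0<P (<-trans P<U U<b)))
    ... | inj₁ σ0<σb = ¬2143 0<P P<U U<b b<n (σP< 0<n (<⇒≢ 0<P)) σ0<σb (<σU b<n (>⇒≢ U<b))
    ... | inj₂ σb<σ0 with m≤n⇒m<n∨m≡n σN<σb
    ...   | inj₂ σN+1≡σb = ¬Consecutive (subst (_< n) N≡b+1 N<n)
                               (inj₂ (trans (sym σN+1≡σb) (cong (λ i → suc (σ ! i)) N≡b+1)))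
    ...   | inj₁ σN+1<σb with preimage (s≤s z≤n) (≤-trans (<⇒≤ σN+1<σb) (proj₂ (range b<n)))
    ...     | y , y<n , σy≡ = ¬4231 (<-trans (s≤s z≤n) 1<y) y<b b<N N<n σN<σy σy<σb σb<σ0
      where
      σy<σb : σ ! y < σ ! b
      σy<σb = subst (_< σ ! b) (sym σy≡) σN+1<σb
      σN<σy : σ ! N < σ ! y
      σN<σy = subst (σ ! N <_) (sym σy≡) ≤-refl
      1<y : 1 < y
      1<y = ≢0∧≢1⇒>1 (λ { refl → <-asym σy<σb σb<σ0 }) (λ { refl → <-asym σy<σb (<-trans σb<σ0 σ0<σ1) })
      y<b : y < b
      y<b = ≤∧≢⇒< (≤-pred (subst (y <_) N≡b+1 (<N y<n (≢-sym (≢values σN<σy))))) (≢values σy<σb)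

  data Site (b : ℕ) : Set where
    at-ℓ   : b ≡ 0 → Site b
    at-A   : b ≡ 1 → Site b
    at-d   : b ≡ P → Site b
    inside : P < b → b < U → Site b
    at-u   : b ≡ U → Site b
    at-r   : b ≡ N → Site b

  site : ∀ {b} → b < n → Site b
  site {zero}          _ = at-ℓ refl
  site {suc zero}      _ = at-A refl
  site {suc (suc zero)} _ = at-d (sym P≡2)
  site {b@(suc (suc (suc _)))} b< with <-cmp b U
  ... | tri< b<U _ _ = inside (subst (_< b) (sym P≡2) (s≤s (s≤s (s≤s z≤n)))) b<U
  ... | tri≈ _ b≡U _ = at-u b≡U
  ... | tri> _ _ U<b = at-r (≤-antisym (≤-pred (subst (b <_) (sym N≡) b<)) (subst (_≤ b) U+1≡N U<b))

  <U : ∀ {e} → e < n → e ≢ N → e ≢ U → e < U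
  <U e< e≢N e≢U = ≤∧≢⇒< (≤-pred (subst (_ <_) (sym U+1≡N) (<N e< e≢N))) e≢U

  inside<n : ∀ {b} → b < U → b < n
  inside<n b<U = <-trans b<U U<n

  InB InD InF : ℕ → Set
  InB b = P < b × b < U × σ ! 0 < σ ! b
  InD b = P < b × b < U × σ ! N < σ ! b × σ ! b < σ ! 0
  InF b = P < b × b < U × σ ! b < σ ! N

  region : ∀ {b} → P < b → b < U → InB b ⊎ InD b ⊎ InF b
  region P<b b<U with compare 0<n (inside<n b<U) (<⇒≢ (<-trans 0<P P<b))
  ... | inj₁ σ0<σb = inj₁ (P<b , b<U , σ0<σb)
  ... | inj₂ σb<σ0 with compare N<n (inside<n b<U) (>⇒≢ (<-trans b<U U<N))
  ...   | inj₁ σN<σb = inj₂ (inj₁ (P<b , b<U , σN<σb , σb<σ0))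
  ...   | inj₂ σb<σN = inj₂ (inj₂ (P<b , b<U , σb<σN))

  ¬132-from-1 : ∀ {c e} → 1 < c → c < e → e < n → σ ! 1 < σ ! e → σ ! e < σ ! c → ⊥
  ¬132-from-1 {c} {e} 1<c c<e e< σ1<σe σe<σc with <-cmp P c
  ... | tri< P<c _ _ = ¬2143 0<P P<c c<e e< (σP< 0<n (<⇒≢ 0<P)) (<-trans σ0<σ1 σ1<σe) σe<σc
  ... | tri≈ _ P≡c _ = <⇒≱ (subst (σ ! e <_) (trans (cong (σ !_) (sym P≡c)) σP≡1) σe<σc) (proj₁ (range e<))
  ... | tri> _ _ c<P = <-irrefl refl (≤-trans 1<c (≤-pred (subst (c <_) P≡2 c<P)))

  ¬132-from-D : ∀ {b c e} → InD b → b < c → c < e → e < n → σ ! b < σ ! e → σ ! e < σ ! c → ⊥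
  ¬132-from-D {b} {c} {e} (P<b , b<U , σN<σb , σb<σ0) b<c c<e e< σb<σe σe<σc
    with compare 0<n e< (<⇒≢ (<-trans 0<P (<-trans P<b (<-trans b<c c<e))))
  ... | inj₁ σ0<σe = ¬2143 0<P (<-trans P<b b<c) c<e e< (σP< 0<n (<⇒≢ 0<P)) σ0<σe σe<σc
  ... | inj₂ σe<σ0 = ¬4231 (<-trans 0<P P<b) (<-trans b<c c<e) (<-trans e<U U<N) N<n σN<σb σb<σe σe<σ0
    where
    e<U : e < U
    e<U = <U e< (λ { refl → <-asym σb<σe σN<σb })
                (λ { refl → <⇒≱ (subst (_< σ ! c) σU≡n σe<σc) (proj₂ (range (<-trans c<e e<))) })

  ¬213-to-D : ∀ {b c e} → InD e → b < c → c < e → σ ! c < σ ! b → σ ! b < σ ! e → ⊥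
  ¬213-to-D {b} {c} {e} (P<e , e<U , σN<σe , σe<σ0) b<c c<e σc<σb σb<σe with site (<-trans b<c (<-trans c<e (inside<n e<U)))
  ... | at-ℓ refl   = <-asym σb<σe σe<σ0
  ... | at-A refl   = <-asym σb<σe (<-trans σe<σ0 σ0<σ1)
  ... | at-d refl   = <⇒≱ (subst (σ ! c <_) σP≡1 σc<σb) (proj₁ (range (<-trans c<e (inside<n e<U))))
  ... | at-u refl   = <-asym (<-trans b<c c<e) e<U
  ... | at-r refl   = <-asym (<-trans (<-trans b<c c<e) e<U) U<N
  ... | inside P<b b<U with compare N<n (inside<n b<U) (>⇒≢ (<-trans b<U U<N))
  ...   | inj₁ σN<σb = ¬4231 (<-trans 0<P P<b) (<-trans b<c c<e) (<-trans e<U U<N) N<n σN<σb σb<σe σe<σ0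
  ...   | inj₂ σb<σN = ¬2143 b<c (<-trans c<e e<U) U<N N<n σc<σb σb<σN (<σU N<n (>⇒≢ U<N))

  ¬12-in-D : ∀ {b c} → InD b → InD c → b < c → σ ! b < σ ! c → ⊥
  ¬12-in-D (P<b , _ , σN<σb , _) (_ , c<U , _ , σc<σ0) b<c σb<σc =
    ¬4231 (<-trans 0<P P<b) b<c (<-trans c<U U<N) N<n σN<σb σb<σc σc<σ0

  ¬21-from-F : ∀ {c e} → InF c → c < e → e < n → σ ! e < σ ! c → ⊥
  ¬21-from-F {c} {e} (P<c , c<U , σc<σN) c<e e< σe<σc = ¬2143 c<e e<U U<N N<n σe<σc σc<σN (<σU N<n (>⇒≢ U<N))
    where
    e<U : e < U
    e<U = <U e< (λ { refl → <-asym σe<σc σc<σN })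
                (λ { refl → <⇒≱ (subst (_< σ ! c) σU≡n σe<σc) (proj₂ (range (inside<n c<U))) })

  ¬21-below-r : ∀ {b c} → b < c → c < N → σ ! c < σ ! b → σ ! b < σ ! N → ⊥
  ¬21-below-r {b} {c} b<c c<N σc<σb σb<σN with <-cmp c U
  ... | tri< c<U _ _ = ¬2143 b<c c<U U<N N<n σc<σb σb<σN (<σU N<n (>⇒≢ U<N))
  ... | tri≈ _ c≡U _ = <⇒≱ (subst (_< σ ! b) (trans (cong (σ !_) c≡U) σU≡n) σc<σb)
                           (proj₂ (range (<-trans b<c (<-trans c<N N<n))))
  ... | tri> _ _ U<c = <-irrefl refl (≤-trans c<N (subst (_≤ c) U+1≡N U<c))

  B-in-321⇒below-σ1 : ∀ {j c e} → InB c → j < c → c < e → σ ! e < σ ! c → σ ! c < σ ! j → σ ! c < σ ! 1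
  B-in-321⇒below-σ1 {j} {c} (P<c , c<U , σ0<σc) j<c c<e _ σc<σj with site (<-trans j<c (inside<n c<U))
  ... | at-ℓ refl       = ⊥-elim (<-asym σ0<σc σc<σj)
  ... | at-A refl       = σc<σj
  ... | at-d refl       = ⊥-elim (<⇒≱ (subst (σ ! c <_) σP≡1 σc<σj) (proj₁ (range (inside<n c<U))))
  ... | inside P<j _    = ⊥-elim (¬2143 0<P P<j j<c (inside<n c<U) (σP< 0<n (<⇒≢ 0<P)) σ0<σc σc<σj)
  ... | at-u refl       = ⊥-elim (<-asym j<c c<U)
  ... | at-r refl       = ⊥-elim (<-asym j<c (<-trans c<U U<N))

  B-below-σ1⇒leftmost : ∀ {b k} → InB b → σ ! b < σ ! 1 → InB k → b ≤ k
  B-below-σ1⇒leftmost {b} {k} (P<b , b<U , σ0<σb) σb<σ1 (P<k , k<U , σ0<σk) with <-cmp b k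
  ... | tri< b<k _ _ = <⇒≤ b<k
  ... | tri≈ _ b≡k _ = ≤-reflexive b≡k
  ... | tri> _ _ k<b with compare (inside<n k<U) (inside<n b<U) (<⇒≢ k<b)
  ...   | inj₁ σk<σb = ⊥-elim (¬4231 (<-trans 1<P P<k) k<b (<-trans b<U U<N) N<n (<-trans σN<σ0 σ0<σk) σk<σb σb<σ1)
  ...   | inj₂ σb<σk = ⊥-elim (¬2143 0<P P<k k<b (inside<n b<U) (σP< 0<n (<⇒≢ 0<P)) σ0<σb σb<σk)

  leftmost-B⇒below-σ1 : ∀ {b} → InB b → (∀ {k} → InB k → b ≤ k) → σ ! b < σ ! 1
  leftmost-B⇒below-σ1 {b} (P<b , b<U , σ0<σb) leftmost with m≤n⇒m<n∨m≡n (leftmost (P<q , q<U , σ0<σq))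
  ... | inj₂ refl = σq<σ1
  ... | inj₁ b<q with compare (inside<n b<U) q<n (<⇒≢ b<q)
  ...   | inj₁ σb<σq = <-trans σb<σq σq<σ1
  ...   | inj₂ σq<σb = ⊥-elim (¬2143 0<P P<b b<q q<n (σP< 0<n (<⇒≢ 0<P)) σ0<σq σq<σb)

-- Avoidance in the inflation

module Type2Inflation (σ : Perm) (P U : ℕ) (αs : List Perm) (len : length αs ≡ length σ)
                       (αs-perm : ∀ α → α ∈ αs → IsPerm α × 1 ≤ length α)
                       (σ-perm : IsPerm σ) (4≤n : 4 ≤ length σ) (simple : Simple σ)
                       (σ⊉2143 : Avoids σ p2143) (σ⊉4231 : Avoids σ p4231)
                       (σP≡1 : σ ! P ≡ 1) (σU≡n : σ ! U ≡ length σ)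
                       (1<P : 1 < P) (P<U : P < U) (U+1<n : suc U < length σ) (σN<σ0 : σ ! (length σ ∸ 1) < σ ! 0)
                       (a : ℕ) (A-unique : ∀ i → Regions.InA σ (suc P) (suc U) i → i ≡ a)
                       (G-empty : ∀ i → ¬ Regions.InG σ (suc P) (suc U) i) where

  module R = Regions σ (suc P) (suc U)

  N : ℕ
  N = length σ ∸ 1

  N≡ : suc N ≡ length σ
  N≡ = suc-pred (length σ) {{>-nonZero (≤-trans (s≤s z≤n) 4≤n)}}

  U<N : U < N
  U<N = ≤-pred (subst (suc U <_) (sym N≡) U+1<n)

  open Type2 σ σ-perm 4≤n simple σ⊉2143 σ⊉4231 P U N N≡ σP≡1 σU≡n 1<P P<U U<N σN<σ0 (pred a)
             (λ 0<b b<P σ0<σb σb<n → cong pred (A-unique _ (s≤s 0<b , s≤s b<P , σ0<σb , σb<n)))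
             (λ U<b b<N 1<σb σb<σN → G-empty _ (s≤s U<b , subst (_ <_) N≡ (s≤s b<N) , 1<σb , σb<σN))
  open Inflation σ αs len σ-perm αs-perm hiding (n)
  open Equivalence using (to; from)

  InB⇒R : ∀ {b} → InB b → R.InB (suc b)
  InB⇒R (P<b , b<U , σ0<σb) = s≤s P<b , s≤s b<U , σ0<σb , σ<n (inside<n b<U) (<⇒≢ b<U)

  R⇒InB : ∀ {b} → R.InB (suc b) → InB b
  R⇒InB (s≤s P<b , s≤s b<U , σ0<σb , _) = P<b , b<U , σ0<σb

  leftmost⇒R : ∀ {b} → (∀ {k} → InB k → b ≤ k) → ∀ j → R.InB j → suc b ≤ j
  leftmost⇒R leftmost (suc k) B-k = s≤s (leftmost (R⇒InB B-k))

  R⇒leftmost : ∀ {b} → (∀ j → R.InB j → suc b ≤ j) → ∀ {k} → InB k → b ≤ k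
  R⇒leftmost leftmost B-k = ≤-pred (leftmost _ (InB⇒R B-k))

  module Necessity (ι⊉2143 : Avoids ι p2143) (ι⊉4231 : Avoids ι p4231) where
    ¬split2143 : ¬ Split2143
    ¬split2143 = ι⊉2143 ∘ from ι⊇2143⇔Split

    ¬split4231 : ¬ Split4231
    ¬split4231 = ι⊉4231 ∘ from ι⊇4231⇔Split

    increasing : ∀ {b} → b < n → ¬ Has21 (α b) → Increasing (α b)
    increasing b< = ¬Has21⇒Increasing (α-perm b<)

    B-increasing : ∀ {b} → InB b → Increasing (α b)
    B-increasing (P<b , b<U , σ0<σb) = increasing (inside<n b<U)
      (¬split2143 ∘ λ has21 → [2][1][43] 0<P P<b (inside<n b<U) has21 (σP< 0<n (<⇒≢ 0<P)) σ0<σb)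

    B-¬Has12 : ∀ {b} → InB b → σ ! b < σ ! 1 → ¬ Has12 (α b)
    B-¬Has12 (P<b , b<U , σ0<σb) σb<σ1 has12 =
      ¬split4231 ([4][23][1] (<-trans 1<P P<b) (<-trans b<U U<N) N<n has12 (<-trans σN<σ0 σ0<σb) σb<σ1)

    α1∈𝓔 : In𝓔 (α 1)
    α1∈𝓔 = (λ α1⊇2143 → ¬split2143 ([2143] 1<n (Contains2143⇒Occurs α1⊇2143))) ,
           (λ α1⊇312 → ¬split4231 ([423][1] 1<P P<n (Contains312⇒Occurs α1⊇312) (σP< 1<n (<⇒≢ 1<P))))

    αN∈𝓕 : In𝓕 (α N)
    αN∈𝓕 = (λ αN⊇2143 → ¬split2143 ([2143] N<n (Contains2143⇒Occurs αN⊇2143))) ,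
           (λ αN⊇231 → ¬split4231 ([4][231] (<-trans 0<P (<-trans P<U U<N)) N<n (Contains231⇒Occurs αN⊇231) σN<σ0))

    α0-increasing : Increasing (α 0)
    α0-increasing = increasing 0<n λ has21 →
      ¬split2143 ([21][4][3] (s≤s z≤n) (<-trans 1<P P<q) q<n has21 σ0<σq σq<σ1)

    increasing-sites : ∀ i → i ≡ suc P ⊎ i ≡ suc U ⊎ (R.InB i × ¬ R.LeftmostB i) ⊎ R.InF i → Increasing (α (i ∸ 1))
    increasing-sites _ (inj₁ refl) = increasing P<n λ has21 →
      ¬split2143 ([21][4][3] P<U U<N N<n has21 (σP< N<n (>⇒≢ (<-trans P<U U<N))) (<σU N<n (>⇒≢ U<N)))
    increasing-sites _ (inj₂ (inj₁ refl)) = increasing U<n λ has21 →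
      ¬split2143 ([2][1][43] 0<P P<U U<n has21 (σP< 0<n (<⇒≢ 0<P)) (<σU 0<n (<⇒≢ (<-trans 0<P P<U))))
    increasing-sites (suc b) (inj₂ (inj₂ (inj₁ (B-b , _)))) = B-increasing (R⇒InB B-b)
    increasing-sites (suc b) (inj₂ (inj₂ (inj₂ (s≤s P<b , s≤s b<U , _ , σb<σN)))) = increasing (inside<n b<U) λ has21 →
      ¬split2143 ([21][4][3] b<U U<N N<n has21 σb<σN (<σU N<n (>⇒≢ U<N)))

    D-decreasing : ∀ i → R.InD i → Decreasing (α (i ∸ 1))
    D-decreasing (suc b) (s≤s P<b , s≤s b<U , σN<σb , σb<σ0) = ¬Has12⇒Decreasing (α-perm (inside<n b<U)) λ has12 →
      ¬split4231 ([4][23][1] (<-trans 0<P P<b) (<-trans b<U U<N) N<n has12 σN<σb σb<σ0)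

    leftmost-B-trivial : ∀ i → R.LeftmostB i → α (i ∸ 1) ≡ 1 ∷ []
    leftmost-B-trivial (suc b) (B-b , leftmost) =
      ¬Has12×¬Has21⇒[1] (α b) (α-perm b<) (α-nonempty b<)
        (B-¬Has12 (R⇒InB B-b) (leftmost-B⇒below-σ1 (R⇒InB B-b) (R⇒leftmost leftmost)))
        (Increasing⇒¬Has21 (B-increasing (R⇒InB B-b)))
      where b< = inside<n (proj₁ (proj₂ (R⇒InB B-b)))

    conditions : R.Conditions αs
    conditions = α1∈𝓔 , αN∈𝓕 , α0-increasing , increasing-sites , D-decreasing , leftmost-B-trivial

  ¬N< : ∀ {x} → N < x → x < n → ⊥
  ¬N< N<x x< = <⇒≱ x< (subst (_≤ _) N≡ N<x)

  module Sufficiency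
    (α1∈𝓔 : In𝓔 (α 1)) (αN∈𝓕 : In𝓕 (α N)) (α0-increasing : Increasing (α 0))
    (increasing-sites : ∀ i → i ≡ suc P ⊎ i ≡ suc U ⊎ (R.InB i × ¬ R.LeftmostB i) ⊎ R.InF i → Increasing (α (i ∸ 1)))
    (D-decreasing : ∀ i → R.InD i → Decreasing (α (i ∸ 1)))
    (leftmost-B-trivial : ∀ i → R.LeftmostB i → α (i ∸ 1) ≡ 1 ∷ []) where

    D-¬Has12 : ∀ {b} → InD b → ¬ Has12 (α b)
    D-¬Has12 (P<b , b<U , σN<σb , σb<σ0) = Decreasing⇒¬Has12 (D-decreasing _ (s≤s P<b , s≤s b<U , σN<σb , σb<σ0))

    -- A leftmost point of B carries [1], any other point of B an increasing block.
    B-¬Has21 : ∀ {b} → InB b → ¬ Has21 (α b)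
    B-¬Has21 {b} B-b has21 = Increasing⇒¬Has21 (increasing-sites (suc b) (inj₂ (inj₂ (inj₁ (InB⇒R B-b , ¬leftmost))))) has21
      where
      ¬leftmost : ¬ R.LeftmostB (suc b)
      ¬leftmost leftmost = [1]⇒¬Has21 (leftmost-B-trivial (suc b) leftmost) has21

    Has21-site : ∀ {b} → b < n → Has21 (α b) → b ≡ 1 ⊎ InD b ⊎ b ≡ N
    Has21-site b< has21 with site b<
    ... | at-ℓ refl = ⊥-elim (Increasing⇒¬Has21 α0-increasing has21)
    ... | at-A refl = inj₁ refl
    ... | at-d refl = ⊥-elim (Increasing⇒¬Has21 (increasing-sites (suc P) (inj₁ refl)) has21)
    ... | at-u refl = ⊥-elim (Increasing⇒¬Has21 (increasing-sites (suc U) (inj₂ (inj₁ refl))) has21)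
    ... | at-r refl = inj₂ (inj₂ refl)
    ... | inside P<b b<U with region P<b b<U
    ...   | inj₁ B-b        = ⊥-elim (B-¬Has21 B-b has21)
    ...   | inj₂ (inj₁ D-b) = inj₂ (inj₁ D-b)
    ...   | inj₂ (inj₂ (_ , _ , σb<σN)) = ⊥-elim (Increasing⇒¬Has21
            (increasing-sites _ (inj₂ (inj₂ (inj₂ (s≤s P<b , s≤s b<U , 1<σ (inside<n b<U) (>⇒≢ P<b) , σb<σN))))) has21)

    ¬split2143 : ¬ Split2143
    ¬split2143 (spread o) = σ⊉2143 (Occurs2143⇒Contains o)
    ¬split2143 ([21][4][3] b<c c<e e< has21 σb<σe σe<σc) with Has21-site (<-trans b<c (<-trans c<e e<)) has21
    ... | inj₁ refl        = ¬132-from-1 b<c c<e e< σb<σe σe<σc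
    ... | inj₂ (inj₁ D-b)  = ¬132-from-D D-b b<c c<e e< σb<σe σe<σc
    ... | inj₂ (inj₂ refl) = ¬N< b<c (<-trans c<e e<)
    ¬split2143 ([2][1][43] b<c c<e e< has21 σc<σb σb<σe) with Has21-site e< has21
    ... | inj₁ refl        = <⇒≱ c<e (≤-trans (s≤s z≤n) b<c)
    ... | inj₂ (inj₁ D-e)  = ¬213-to-D D-e b<c c<e σc<σb σb<σe
    ... | inj₂ (inj₂ refl) = ¬21-below-r b<c c<e σc<σb σb<σe
    ¬split2143 ([21][43] b<c c< has21-b has21-c σb<σc) with Has21-site (<-trans b<c c<) has21-b | Has21-site c< has21-c
    ... | inj₁ refl             | inj₁ refl                  = <-irrefl refl b<c
    ... | inj₁ refl             | inj₂ (inj₁ (_ , _ , _ , σc<σ0)) = <-asym (<-trans σb<σc σc<σ0) σ0<σ1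
    ... | inj₁ refl             | inj₂ (inj₂ refl)           = <-asym σb<σc σN<σ1
    ... | inj₂ (inj₁ (P<b , _)) | inj₁ refl                  = <-asym b<c (<-trans 1<P P<b)
    ... | inj₂ (inj₁ D-b)       | inj₂ (inj₁ D-c)            = ¬12-in-D D-b D-c b<c σb<σc
    ... | inj₂ (inj₁ (_ , _ , σN<σb , _)) | inj₂ (inj₂ refl) = <-asym σb<σc σN<σb
    ... | inj₂ (inj₂ refl)      | _                          = ¬N< b<c c<
    ¬split2143 ([2143] b< o) with Has21-site b< (Occurs2143⇒Has21 {α _} o)
    ... | inj₁ refl        = proj₁ α1∈𝓔 (Occurs2143⇒Contains o)
    ... | inj₂ (inj₁ D-b)  = D-¬Has12 D-b (Occurs2143⇒Has12 {α _} o)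
    ... | inj₂ (inj₂ refl) = proj₁ αN∈𝓕 (Occurs2143⇒Contains o)

    ¬split4231 : ¬ Split4231
    ¬split4231 (spread o) = σ⊉4231 (Occurs4231⇒Contains o)
    ¬split4231 ([4][23][1] {b} {c} b<c c<e e< has12 σe<σc σc<σb) with site (<-trans c<e e<)
    ... | at-ℓ refl = <⇒≱ b<c z≤n
    ... | at-A refl with b<c
    ...   | s≤s z≤n = <-asym σc<σb σ0<σ1
    ¬split4231 ([4][23][1] b<c c<e e< has12 σe<σc σc<σb) | at-d refl = <⇒≱ (subst (_ <_) σP≡1 σe<σc) (proj₁ (range e<))
    ¬split4231 ([4][23][1] b<c c<e e< has12 σe<σc σc<σb) | at-u refl =
      <⇒≱ (subst (_< _) σU≡n σc<σb) (proj₂ (range (<-trans b<c (<-trans c<e e<))))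
    ¬split4231 ([4][23][1] b<c c<e e< has12 σe<σc σc<σb) | at-r refl = ¬N< c<e e<
    ¬split4231 ([4][23][1] {b} {c} b<c c<e e< has12 σe<σc σc<σb) | inside P<c c<U with region P<c c<U
    ... | inj₁ B-c = [1]⇒¬Has12 (leftmost-B-trivial (suc c) (InB⇒R B-c , leftmost⇒R leftmost)) has12
      where
      leftmost : ∀ {k} → InB k → c ≤ k
      leftmost = B-below-σ1⇒leftmost B-c (B-in-321⇒below-σ1 B-c b<c c<e σe<σc σc<σb)
    ... | inj₂ (inj₁ D-c) = D-¬Has12 D-c has12
    ... | inj₂ (inj₂ F-c) = ¬21-from-F F-c c<e e< σe<σc
    ¬split4231 ([423][1] b<e e< o σe<σb) with Has21-site (<-trans b<e e<) (Occurs312⇒Has21 {α _} o)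
    ... | inj₁ refl        = proj₂ α1∈𝓔 (Occurs312⇒Contains o)
    ... | inj₂ (inj₁ D-b)  = D-¬Has12 D-b (Occurs312⇒Has12 {α _} o)
    ... | inj₂ (inj₂ refl) = ¬N< b<e e<
    ¬split4231 ([4][231] b<c c< o σc<σb) with Has21-site c< (Occurs231⇒Has21 {α _} o)
    ... | inj₁ refl with b<c
    ...   | s≤s z≤n = <-asym σc<σb σ0<σ1
    ¬split4231 ([4][231] b<c c< o σc<σb) | inj₂ (inj₁ D-c)  = D-¬Has12 D-c (Occurs231⇒Has12 {α _} o)
    ¬split4231 ([4][231] b<c c< o σc<σb) | inj₂ (inj₂ refl) = proj₂ αN∈𝓕 (Occurs231⇒Contains o)
    ¬split4231 ([4231] b< o) with Has21-site b< (Occurs312⇒Has21 {α _} (Occurs4231⇒Occurs312 {α _} o))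
    ... | inj₁ refl        = proj₂ α1∈𝓔 (Occurs312⇒Contains (Occurs4231⇒Occurs312 {α _} o))
    ... | inj₂ (inj₁ D-b)  = D-¬Has12 D-b (Occurs312⇒Has12 {α _} (Occurs4231⇒Occurs312 {α _} o))
    ... | inj₂ (inj₂ refl) = proj₂ αN∈𝓕 (Occurs231⇒Contains (Occurs4231⇒Occurs231 {α _} o))

    avoidance : Avoids ι p2143 × Avoids ι p4231
    avoidance = ¬split2143 ∘ to ι⊇2143⇔Split , ¬split4231 ∘ to ι⊇4231⇔Split

lemma6 : (σ : Perm) (pd pu : ℕ) → Regions.Type2 σ pd pu →
         (αs : List Perm) → length αs ≡ length σ →
         (∀ α → α ∈ αs → IsPerm α × 1 ≤ length α) →
         ((Avoids (inflate σ αs) p2143 × Avoids (inflate σ αs) p4231)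
           ⇔ Regions.Conditions σ pd pu αs)
lemma6 σ zero    pu      ((_ , _ , _ , _ , _ , _ , _ , () , _) , _) _ _ _
lemma6 σ (suc P) zero    ((_ , _ , _ , _ , _ , _ , _ , _ , () , _) , _) _ _ _
lemma6 σ (suc P) (suc U)
  ((σ-perm , 4≤n , simple , σ⊉2143 , σ⊉4231 , σP≡1 , σU≡n , _ , s≤s P<U , U+1<n , σN<σ0) ,
   (a , (1<a , a<pd , _) , A-unique) , G-empty)
  αs len αs-perm =
  mk⇔ (λ (ι⊉2143 , ι⊉4231) → Necessity.conditions ι⊉2143 ι⊉4231)
      (λ (c₁ , c₂ , c₃ , c₄ , c₅ , c₆) → Sufficiency.avoidance c₁ c₂ c₃ c₄ c₅ c₆)
  where
  open Type2Inflation σ P U αs len αs-perm σ-perm 4≤n simple σ⊉2143 σ⊉4231 σP≡1 σU≡n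
                      (<-≤-trans 1<a (≤-pred a<pd)) P<U U+1<n σN<σ0 a A-unique G-empty
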